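{- Let $\ell\in\mathbb{N}$. Suppose $\Gamma\vdash M[N/x]:(u\oplus_\ell w,\tau)$ is derivable in the extended type system, where $N$ is closed, has order $\ell$, and no variable of order at least $\ell$ occurs in $N$. Then there exist a set of indices $I$ with $0\notin I$, functions $u_0'$ and $w_i'$ ($i\in\{0\}\cup I$) from $\Sigma_{\mathsf{a}}$ to $\mathbb{N}$, and types $\tau_i$ ($i\in I$) such that, setting $A_i=\{a\in\Sigma_{\mathsf{a}}\mid w_i'(a)>0\}$ for $i\in I$: every pair occurs as $(A_i,\tau_i)$ for at most $s$ indices $i\in I$; the judgments $\Gamma\cup\{x:(A_i,\tau_i)\mid i\in I\}\vdash M:(u_0'\oplus_\ell w_0',\tau)$ and $\emptyset\vdash N:(\mathbf{0}\oplus_\ell w_i',\tau_i)$ for all $i\in I$ are derivable; and for all $a\in\Sigma_{\mathsf{a}}$: $2^{u(a)}\cdot w(a)\le 2^{u_0'(a)}\cdot\sum_{i\in\{0\}\cup I}w_i'(a)$, $u(a)\le u_0'(a)$, and ($u(a)+w(a)=0\Rightarrow u_0'(a)+\sum_{i\in\{0\}\cup I}w_i'(a)=0$).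
   Context: Fix $s\ge1$. Sorts are built from $\mathsf{o}$ by $\to$; $\mathit{ord}(\mathsf{o})=0$, $\mathit{ord}(\alpha\to\beta)=\max(1+\mathit{ord}(\alpha),\mathit{ord}(\beta))$; the order of a term or variable is that of its sort. Lambda-terms are (possibly infinitary) simply-typed lambda-terms, up to alpha-conversion, over constants $\mathsf{a}_1,\dots,\mathsf{a}_s:\mathsf{o}\to\mathsf{o}$ ($\Sigma_{\mathsf{a}}=\{\mathsf{a}_1,\dots,\mathsf{a}_s\}$), $\mathsf{b}:\mathsf{o}\to\mathsf{o}\to\mathsf{o}$, $\mathsf{c},\omega:\mathsf{o}$. An $s$-multiset is a multiset with at most $s$ copies of each element; $\mathcal{P}_{\le s}(X)$ is the set of such over $X$; the union $U\cup V$ has $\min(n+m,s)$ copies of an element occurring $n$ times in $U$ and $m$ in $V$; $\{x_i\mid i\in I\}$ means $\bigcup_{i\in I}\{x_i\}$. Types: $\mathcal{T}_s^{\mathsf{o}}=\{\mathsf{r}\}$, $\mathcal{T}_s^{\alpha\to\beta}=\mathcal{P}_{\le s}(\mathcal{P}(\Sigma_{\mathsf{a}})\times\mathcal{T}_s^\alpha)\times\mathcal{T}_s^\beta$, written $\bigwedge_{i\in I}(A_i,\tau_i)\to\tau$ (each pair at most $s$ times); $\top$ empty. Environments $\Gamma$ are $s$-multisets of bindings $x:(A,\sigma)$ ($A\subseteq\Sigma_{\mathsf{a}}$, $\sigma$ of the sort of $x$); $\mathit{dom}(\Gamma)$ the bound variables; $\Gamma{\restriction}_a$ the bindings whose set contains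 $a$; $\Gamma{\restriction}_{\ge\ell}$, $\Gamma{\restriction}_{<\ell}$ the bindings of variables of order $\ge\ell$, resp. $<\ell$. $\mathbf{0}$ is constantly $0$ on $\Sigma_{\mathsf{a}}$; $\chi_i$ maps $\mathsf{a}_i$ to $1$, others to $0$; $\mathit{dupl}((\Gamma_j)_{j\in J})(a)=\sum_{j\in J}|\Gamma_j{\restriction}_a|-|\bigcup_{j\in J}\Gamma_j{\restriction}_a|$. Extended type system (for fixed $\ell$): judgments $\Gamma\vdash M:(u\oplus_\ell w,\tau)$ with $u,w:\Sigma_{\mathsf{a}}\to\mathbb{N}$, derived by finite derivations from: $\emptyset\vdash\mathsf{a}_i:(\mathbf{0}\oplus_\ell\chi_i,(A,\mathsf{r})\to\mathsf{r})$; $\emptyset\vdash\mathsf{c}:(\mathbf{0}\oplus_\ell\mathbf{0},\mathsf{r})$; $\emptyset\vdash\mathsf{b}:(\mathbf{0}\oplus_\ell\mathbf{0},(A,\mathsf{r})\to\top\to\mathsf{r})$; $\emptyset\vdash\mathsf{b}:(\mathbf{0}\oplus_\ell\mathbf{0},\top\to(A,\mathsf{r})\to\mathsf{r})$; $x:(A,\tau)\vdash x:(\mathbf{0}\oplus_\ell\mathbf{0},\tau)$; ($\lambda$): from $\Gamma\cup\{x:(A_i,\tau_i)\mid i\in I\}\vdash K:(u\oplus_\ell w,\tau)$, $x\notin\mathit{dom}(\Gamma)$, infer $\Gamma\vdash\lambda x.K:(u\oplus_\ell w,\bigwedge_{i\in I}(A_i,\tau_i)\to\tau)$; ($@$): if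 $0\notin I$, $\Gamma_0\vdash K:(u_0\oplus_\ell w_0,\bigwedge_{i\in I}(A_i,\tau_i)\to\tau)$, and $\Gamma_i\vdash L:(u_i\oplus_\ell w_i,\tau_i)$ for $i\in I$ with $A_i=\{a\mid u_i(a)+w_i(a)>0\lor\Gamma_i{\restriction}_a\ne\emptyset\}$, infer $\bigcup_{i\in\{0\}\cup I}\Gamma_i\vdash K\,L:(u\oplus_\ell w,\tau)$ with $u=\mathit{dupl}((\Gamma_i{\restriction}_{\ge\ell})_{i\in\{0\}\cup I})+\sum_{i\in\{0\}\cup I}u_i$ and $w=\mathit{dupl}((\Gamma_i{\restriction}_{<\ell})_{i\in\{0\}\cup I})+\sum_{i\in\{0\}\cup I}w_i$. No rule for $\omega$. -}

module Defs where

open import Data.Nat using (ℕ; zero; suc; _+_; _∸_; _⊔_; _≤ᵇ_; _<ᵇ_; _≤_; _<_)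
open import Data.Bool using (Bool; true; false; if_then_else_; _∧_)
open import Data.Fin using (Fin)
import Data.Fin as Fin
open import Data.Fin.Subset using (Subset; _∈_)
open import Data.Vec using (Vec; []; _∷_)
import Data.Vec as Vec
open import Data.List using (List; []; _∷_; _++_; length; lookup; tabulate; map; foldr; filterᵇ)
open import Data.List.Relation.Unary.All using (All)
open import Data.Product using (Σ; _×_; _,_; proj₁; proj₂)
open import Data.Sum using (_⊎_; inj₁; inj₂)
import Data.Sum as Sum
open import Function using (_∘_)
open import Function.Bundles using (_⇔_)
open import Relation.Nullary using (does; ¬_)
open import Relation.Binary.PropositionalEquality using (_≡_; _≢_; refl)

infixr 5 _⇒_
data Sort : Set where
  o   : Sort
  _⇒_ : Sort → Sort → Sort

ord : Sort → ℕ
ord o       = 0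
ord (α ⇒ β) = suc (ord α) ⊔ ord β

Ctx : Set
Ctx = List Sort

data Var : Ctx → Sort → Set where
  here  : ∀ {Δ α} → Var (α ∷ Δ) α
  there : ∀ {Δ α β} → Var Δ α → Var (β ∷ Δ) α

data Cmp : Set where
  lt eq gt : Cmp

lexC : Cmp → Cmp → Cmp
lexC eq c = c
lexC lt _ = lt
lexC gt _ = gt

isEq : Cmp → Bool
isEq eq = true
isEq _  = false

cmpBool : Bool → Bool → Cmp
cmpBool false false = eq
cmpBool false true  = lt
cmpBool true  false = gt
cmpBool true  true  = eq

cmpVec : ∀ {n} → Vec Bool n → Vec Bool n → Cmp
cmpVec []       []       = eq
cmpVec (x ∷ xs) (y ∷ ys) = lexC (cmpBool x y) (cmpVec xs ys)

module _ (s : ℕ) where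

  -- Types.  Σₐ = Fin s, a subset A ⊆ Σₐ is a 'Subset s'.
  -- A type of sort α ⇒ β is an s-multiset of pairs (A , τ) together with
  -- a result type; s-multisets are represented canonically as sorted
  -- lists with at most s copies of each element (see 'Canon').

  Sub : Set
  Sub = Subset s

  infixr 5 _⟶_
  data Ty : Sort → Set where
    r    : Ty o
    _⟶_  : ∀ {α β} → List (Sub × Ty α) → Ty β → Ty (α ⇒ β)

  mutual
    cmpTy : ∀ {α} → Ty α → Ty α → Cmp
    cmpTy r        r          = eq
    cmpTy (l ⟶ t) (l' ⟶ t') = lexC (cmpPairs l l') (cmpTy t t')

    cmpPairs : ∀ {α} → List (Sub × Ty α) → List (Sub × Ty α) → Cmp
    cmpPairs []             []               = eq
    cmpPairs []             (_ ∷ _)          = lt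
    cmpPairs (_ ∷ _)        []               = gt
    cmpPairs ((A , t) ∷ l)  ((B , t') ∷ l')  =
      lexC (lexC (cmpVec A B) (cmpTy t t')) (cmpPairs l l')

  cmpPair : ∀ {α} → Sub × Ty α → Sub × Ty α → Cmp
  cmpPair (A , t) (B , t') = lexC (cmpVec A B) (cmpTy t t')

  MSet : Sort → Set
  MSet α = List (Sub × Ty α)

  module _ {α : Sort} where
    insert : Sub × Ty α → MSet α → MSet α
    insert x []       = x ∷ []
    insert x (y ∷ ys) with cmpPair x y
    ... | gt = y ∷ insert x ys
    ... | _  = x ∷ y ∷ ys

    sortM : MSet α → MSet α
    sortM = foldr insert []

    countEq : Sub × Ty α → MSet α → ℕ
    countEq x []       = 0
    countEq x (y ∷ ys) = (if isEq (cmpPair x y) then 1 else 0) + countEq x ys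

    capGo : MSet α → MSet α → MSet α
    capGo acc []       = []
    capGo acc (x ∷ xs) =
      if countEq x acc <ᵇ s then x ∷ capGo (x ∷ acc) xs else capGo acc xs

    norm : MSet α → MSet α
    norm l = sortM (capGo [] l)

    -- union of s-multisets (min (n + m) s copies)
    _∪ₘ_ : MSet α → MSet α → MSet α
    U ∪ₘ V = norm (U ++ V)

  data Canon : ∀ {α} → Ty α → Set where
    canon-r : Canon r
    canon-⟶ : ∀ {α β} {l : List (Sub × Ty α)} {t : Ty β} →
              All (λ p → Canon (proj₂ p)) l → Canon t → norm l ≡ l →
              Canon (l ⟶ t)

  -- Environments: for every variable of the context, the s-multiset of
  -- pairs (A , σ) with which it is bound (a binding x : (A , σ)).

  data Env : Ctx → Set where
    []  : Env []
    _∷_ : ∀ {α Δ} → MSet α → Env Δ → Env (α ∷ Δ)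

  ∅ₑ : ∀ {Δ} → Env Δ
  ∅ₑ {[]}    = []
  ∅ₑ {_ ∷ _} = [] ∷ ∅ₑ

  infixl 6 _∪ₑ_
  _∪ₑ_ : ∀ {Δ} → Env Δ → Env Δ → Env Δ
  []       ∪ₑ []       = []
  (U ∷ Γ)  ∪ₑ (V ∷ Γ') = (U ∪ₘ V) ∷ (Γ ∪ₑ Γ')

  ⋃ₑ : ∀ {Δ} → List (Env Δ) → Env Δ
  ⋃ₑ = foldr _∪ₑ_ ∅ₑ

  singleₑ : ∀ {Δ α} → Var Δ α → Sub × Ty α → Env Δ
  singleₑ here      p = (p ∷ []) ∷ ∅ₑ
  singleₑ (there v) p = [] ∷ singleₑ v p

  restrictA : ∀ {Δ} → Fin s → Env Δ → Env Δ
  restrictA a []      = []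
  restrictA a (U ∷ Γ) = filterᵇ (λ p → Vec.lookup (proj₁ p) a) U ∷ restrictA a Γ

  restrict≥ : ∀ {Δ} → ℕ → Env Δ → Env Δ
  restrict≥ ℓ []                 = []
  restrict≥ ℓ (_∷_ {α} U Γ) = (if ℓ ≤ᵇ ord α then U else []) ∷ restrict≥ ℓ Γ

  restrict< : ∀ {Δ} → ℕ → Env Δ → Env Δ
  restrict< ℓ []                 = []
  restrict< ℓ (_∷_ {α} U Γ) = (if ord α <ᵇ ℓ then U else []) ∷ restrict< ℓ Γ

  size : ∀ {Δ} → Env Δ → ℕ
  size []      = 0
  size (U ∷ Γ) = length U + size Γ

  sumL : List ℕ → ℕ
  sumL = foldr _+_ 0

  dupl : ∀ {Δ} → List (Env Δ) → Fin s → ℕ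
  dupl Gs a = sumL (map (λ G → size (restrictA a G)) Gs)
              ∸ size (⋃ₑ (map (restrictA a) Gs))

  ∑ : ∀ {k} → (Fin k → ℕ) → ℕ
  ∑ {zero}  f = 0
  ∑ {suc k} f = f Fin.zero + ∑ (f ∘ Fin.suc)

  χ : Fin s → Fin s → ℕ
  χ i a = if does (i Fin.≟ a) then 1 else 0

  -- (Possibly infinitary) simply-typed lambda-terms, presented as states
  -- of a coalgebra (a system of equations): every state unfolds to one
  -- node whose children are again states.

  data NodeF (S : Ctx → Sort → Set) (Δ : Ctx) : Sort → Set where
    var  : ∀ {α} → Var Δ α → NodeF S Δ α
    lam  : ∀ {α β} → S (α ∷ Δ) β → NodeF S Δ (α ⇒ β)
    app  : ∀ {α β} → S Δ (α ⇒ β) → S Δ α → NodeF S Δ β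
    cA   : Fin s → NodeF S Δ (o ⇒ o)
    cB   : NodeF S Δ (o ⇒ o ⇒ o)
    cC   : NodeF S Δ o
    cΩ   : NodeF S Δ o

  record Sys : Set₁ where
    field
      St   : Ctx → Sort → Set
      step : ∀ {Δ α} → St Δ α → NodeF St Δ α

  record Term (Δ : Ctx) (α : Sort) : Set₁ where
    field
      sys  : Sys
      root : Sys.St sys Δ α

  open Sys
  open Term

  -- Substitution M[N/x] of a closed term N : σ for the variable x (the
  -- variable 'here' of M's context σ ∷ Δ).  N closed ⇒ no capture.

  injectV : ∀ {F β} (E : Ctx) → Var F β → Var (F ++ E) β
  injectV E here      = here
  injectV E (there v) = there (injectV E v)

  module Subst {σ Δ α} (M : Term (σ ∷ Δ) α) (N : Term [] σ) where
    SM = sys M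
    SN = sys N

    data St' (Γ : Ctx) (β : Sort) : Set where
      inM : (E : Ctx) → Γ ≡ E ++ Δ → St SM (E ++ σ ∷ Δ) β → St' Γ β
      inN : (F E : Ctx) → Γ ≡ F ++ E → St SN F β → St' Γ β

    splitV : ∀ {β} (E : Ctx) → Var (E ++ σ ∷ Δ) β → (β ≡ σ) ⊎ Var (E ++ Δ) β
    splitV []      here      = inj₁ refl
    splitV []      (there v) = inj₂ v
    splitV (γ ∷ E) here      = inj₂ here
    splitV (γ ∷ E) (there v) = Sum.map₂ there (splitV E v)

    liftN : ∀ {F β} (E : Ctx) → NodeF (St SN) F β → NodeF St' (F ++ E) β
    liftN E (var v)   = var (injectV E v)
    liftN {F} E (lam {α = γ} z) = lam (inN (γ ∷ F) E refl z)
    liftN {F} E (app K L) = app (inN F E refl K) (inN F E refl L)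
    liftN E (cA i)    = cA i
    liftN E cB        = cB
    liftN E cC        = cC
    liftN E cΩ        = cΩ

    stepM : ∀ {β} (E : Ctx) → NodeF (St SM) (E ++ σ ∷ Δ) β → NodeF St' (E ++ Δ) β
    stepM E (var v) with splitV E v
    ... | inj₁ refl = liftN (E ++ Δ) (step SN (root N))
    ... | inj₂ v'   = var v'
    stepM E (lam {α = γ} y) = lam (inM (γ ∷ E) refl y)
    stepM E (app K L) = app (inM E refl K) (inM E refl L)
    stepM E (cA i)    = cA i
    stepM E cB        = cB
    stepM E cC        = cC
    stepM E cΩ        = cΩ

    step' : ∀ {Γ β} → St' Γ β → NodeF St' Γ β
    step' (inM E refl x)   = stepM E (step SM x)
    step' (inN F E refl y) = liftN E (step SN y)

    result : Term Δ α
    result = record { sys = record { St = St' ; step = step' }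
                    ; root = inM [] refl (root M) }

  _[_/x] : ∀ {σ Δ α} → Term (σ ∷ Δ) α → Term [] σ → Term Δ α
  M [ N /x] = Subst.result M N

  -- "a variable of order ≥ ℓ occurs in the term" (an occurrence is a
  -- variable node reachable by a finite path from the root)

  module _ (S : Sys) (ℓ : ℕ) where
    data Occ : ∀ {Δ α} → St S Δ α → Set where
      occ-var  : ∀ {Δ α} {x : St S Δ α} {v : Var Δ α} →
                 step S x ≡ var v → ℓ ≤ ord α → Occ x
      occ-lam  : ∀ {Δ α β} {x : St S Δ (α ⇒ β)} {y} →
                 step S x ≡ lam y → Occ y → Occ x
      occ-appL : ∀ {Δ α β} {x : St S Δ β} {K : St S Δ (α ⇒ β)} {L} →
                 step S x ≡ app K L → Occ K → Occ x
      occ-appR : ∀ {Δ α β} {x : St S Δ β} {K : St S Δ (α ⇒ β)} {L} →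
                 step S x ≡ app K L → Occ L → Occ x

  VarOfOrder≥Occurs : ∀ {Δ α} → ℕ → Term Δ α → Set
  VarOfOrder≥Occurs ℓ N = Occ (sys N) ℓ (root N)

  module _ (S : Sys) (ℓ : ℕ) where
    data J : ∀ {Δ α} → Env Δ → St S Δ α → (Fin s → ℕ) → (Fin s → ℕ) → Ty α → Set where
      j-a   : ∀ {Δ} {x : St S Δ (o ⇒ o)} {i A u w} →
              step S x ≡ cA i → (∀ a → u a ≡ 0) → (∀ a → w a ≡ χ i a) →
              J ∅ₑ x u w (((A , r) ∷ []) ⟶ r)
      j-c   : ∀ {Δ} {x : St S Δ o} {u w} →
              step S x ≡ cC → (∀ a → u a ≡ 0) → (∀ a → w a ≡ 0) →
              J ∅ₑ x u w r
      j-b₁  : ∀ {Δ} {x : St S Δ (o ⇒ o ⇒ o)} {A u w} →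
              step S x ≡ cB → (∀ a → u a ≡ 0) → (∀ a → w a ≡ 0) →
              J ∅ₑ x u w (((A , r) ∷ []) ⟶ ([] ⟶ r))
      j-b₂  : ∀ {Δ} {x : St S Δ (o ⇒ o ⇒ o)} {A u w} →
              step S x ≡ cB → (∀ a → u a ≡ 0) → (∀ a → w a ≡ 0) →
              J ∅ₑ x u w ([] ⟶ (((A , r) ∷ []) ⟶ r))
      j-var : ∀ {Δ α} {x : St S Δ α} {v : Var Δ α} {A τ u w} →
              step S x ≡ var v → Canon τ →
              (∀ a → u a ≡ 0) → (∀ a → w a ≡ 0) →
              J (singleₑ v (A , τ)) x u w τ
      j-lam : ∀ {Δ α β} {x : St S Δ (α ⇒ β)} {y : St S (α ∷ Δ) β}
                {Γ : Env Δ} {m : MSet α} {u w τ} →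
              step S x ≡ lam y → J (m ∷ Γ) y u w τ →
              J Γ x u w (m ⟶ τ)
      j-app : ∀ {Δ α β} {x : St S Δ β} {K : St S Δ (α ⇒ β)} {L : St S Δ α}
                {m : MSet α} {τ : Ty β} {u w} →
              step S x ≡ app K L →
              (Γ₀ : Env Δ) (u₀ w₀ : Fin s → ℕ) → J Γ₀ K u₀ w₀ (m ⟶ τ) →
              (Γs : Fin (length m) → Env Δ) (us ws : Fin (length m) → Fin s → ℕ) →
              (∀ i → J (Γs i) L (us i) (ws i) (proj₂ (lookup m i))) →
              (∀ i a → (a ∈ proj₁ (lookup m i)) ⇔
                       ((0 < us i a + ws i a) ⊎ (restrictA a (Γs i) ≢ ∅ₑ))) →
              (∀ a → u a ≡ dupl (map (restrict≥ ℓ) (Γ₀ ∷ tabulate Γs)) a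
                           + (u₀ a + ∑ (λ i → us i a))) →
              (∀ a → w a ≡ dupl (map (restrict< ℓ) (Γ₀ ∷ tabulate Γs)) a
                           + (w₀ a + ∑ (λ i → ws i a))) →
              J (⋃ₑ (Γ₀ ∷ tabulate Γs)) x u w τ

  Derivable : ∀ {Δ α} → ℕ → Env Δ → Term Δ α → (Fin s → ℕ) → (Fin s → ℕ) → Ty α → Set
  Derivable ℓ Γ M u w τ = J (sys M) ℓ Γ (root M) u w τ

  family : ∀ {α k} → (Fin k → Sub × Ty α) → MSet α
  family f = norm (tabulate f)

  support : (Fin s → ℕ) → Sub
  support f = Vec.tabulate (λ a → 0 <ᵇ f a)

  AtMostS : ∀ {A : Set} {k} → (Fin k → A) → Set
  AtMostS {A} {k} f = ∀ (p : A) (g : Fin (suc s) → Fin k) →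
    (∀ i j → g i ≡ g j → i ≡ j) → ¬ (∀ j → f (g j) ≡ p)

module Submission where

-- Every occurrence of x was replaced by a copy of N; as N is
-- closed, the subderivation for a copy is a derivation ∅ ⊢ N : (0 ⊕ wᵢ, τᵢ) (the u-part vanishes
-- because N has no variable of order ≥ ℓ). Replacing it by the variable rule turns the derivation
-- into one for M with x bound to the union of the pairs (supp wᵢ, τᵢ). Since x has order ℓ, a copy
-- lost in one of these unions is charged to u₀′, one unit for each letter of its set.
-- Unions keep at most s copies of a pair, so the copies themselves must be pruned: among s + 1 of
-- them with the same pair, set aside one of maximal weight for each of the s letters; the copy
-- left over is dominated letterwise by the others, so dropping it at most doubles the weight at the
-- letters of its set, which is paid for by the factor 2 ^ (u₀′ a − u a).

open import Defs
open import Data.Nat using (ℕ; _+_; _*_; _^_; _≤_)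
open import Data.Fin using (Fin)
open import Data.List using ([]; _∷_)
open import Data.Product using (Σ; _×_; _,_)
open import Relation.Nullary using (¬_)
open import Relation.Binary.PropositionalEquality using (_≡_)

open import Data.Bool using (Bool; true; false; if_then_else_; T)
open import Data.Bool.Properties using (T-≡)
open import Data.Empty using (⊥-elim)
open import Data.Fin.Properties using (any?; punchIn-injective; punchInᵢ≢i; punchIn-punchOut)
import Data.Fin as Fin
open import Data.Fin.Subset using (_∈_)
open import Data.List using (List; _++_; length; foldr; filterᵇ; map; tabulate; lookup; concat; allFin)
open import Data.List.Properties using (length-++; map-++; map-tabulate; tabulate-cong; tabulate-lookup; length-tabulate)
open import Data.List.Membership.Propositional.Properties using (∈-allFin)
open import Data.List.Relation.Unary.All using (All; []; _∷_)
import Data.List.Relation.Unary.All as All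
open import Data.List.Relation.Unary.All.Properties using (++⁺; tabulate⁺)
open import Data.List.Relation.Binary.Permutation.Propositional as ↭ using (_↭_; ↭-sym; ↭-trans)
open import Data.List.Relation.Binary.Permutation.Propositional.Properties
  using (map⁺; ↭-length; All-resp-↭; filter-↭; shift; ++⁺ʳ)
open import Data.Nat using (zero; suc; _∸_; _⊓_; _≤ᵇ_; _<ᵇ_; _<_; _≤?_; _<?_; z≤n; s≤s)
open import Data.Nat.ListAction.Properties using (sum-++; sum-↭)
open import Data.Nat.Properties
open import Algebra.Properties.CommutativeSemigroup +-commutativeSemigroup
  using (interchange; x∙yz≈y∙xz; xy∙z≈y∙xz)
open import Algebra.Properties.CommutativeSemigroup *-commutativeSemigroup
  using () renaming (x∙yz≈y∙xz to x*[y*z]≡y*[x*z])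
open import Data.Product using (proj₁; proj₂; uncurry)
open import Data.Sum using (_⊎_; inj₁; inj₂)
open import Data.Sum.Function.Propositional using (_⊎-⇔_)
open import Data.Unit using (⊤; tt)
open import Data.Vec using (Vec; []; _∷_)
import Data.Vec as Vec
open import Data.Vec.Properties using (lookup∘tabulate)
open import Function using (_∘_)
open import Function.Bundles using (_⇔_; mk⇔; Equivalence)
open import Function.Properties.Equivalence using () renaming (refl to ⇔-refl; trans to ⇔-trans)
open import Relation.Binary.Definitions using (DecidableEquality)
open import Relation.Binary.PropositionalEquality hiding (J)
open import Relation.Nullary using (yes; no)

open Sys

<ᵇ≡true⇒< : ∀ m n → (m <ᵇ n) ≡ true → m < n
<ᵇ≡true⇒< m n e = <ᵇ⇒< m n (subst T (sym e) _)

<ᵇ≡false⇒≥ : ∀ m n → (m <ᵇ n) ≡ false → n ≤ m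
<ᵇ≡false⇒≥ m n e = ≮⇒≥ (λ m<n → subst T e (<⇒<ᵇ m<n))

m+n⊓k⊓k≡m+n⊓k : ∀ m n k → (m + n ⊓ k) ⊓ k ≡ (m + n) ⊓ k
m+n⊓k⊓k≡m+n⊓k m n k with n ≤? k
... | yes n≤k rewrite m≤n⇒m⊓n≡m n≤k = refl
... | no  n≰k rewrite m≥n⇒m⊓n≡n (<⇒≤ (≰⇒> n≰k)) =
  trans (m≥n⇒m⊓n≡n (m≤n+m k m)) (sym (m≥n⇒m⊓n≡n (≤-trans (<⇒≤ (≰⇒> n≰k)) (m≤n+m n m))))

n≤2^m*n : ∀ m n → n ≤ 2 ^ m * n
n≤2^m*n m n = m≤n*m n (2 ^ m) {{m^n≢0 2 m}}

[m+n]∸[j+k]≡[m∸j]+[n∸k] : ∀ m n j k → j ≤ m → k ≤ n → (m + n) ∸ (j + k) ≡ (m ∸ j) + (n ∸ k)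
[m+n]∸[j+k]≡[m∸j]+[n∸k] m n j k j≤m k≤n = begin
  (m + n) ∸ (j + k)                       ≡⟨ cong₂ (λ x y → (x + y) ∸ (j + k)) (sym (m∸n+n≡m j≤m)) (sym (m∸n+n≡m k≤n)) ⟩
  ((m ∸ j + j) + (n ∸ k + k)) ∸ (j + k)   ≡⟨ cong (_∸ (j + k)) (interchange (m ∸ j) j (n ∸ k) k) ⟩
  ((m ∸ j + (n ∸ k)) + (j + k)) ∸ (j + k) ≡⟨ m+n∸n≡m _ (j + k) ⟩
  (m ∸ j) + (n ∸ k)                       ∎
  where open ≡-Reasoning

flipCmp : Cmp → Cmp
flipCmp lt = gt
flipCmp eq = eq
flipCmp gt = lt

lexC-flip : ∀ c d → lexC (flipCmp c) (flipCmp d) ≡ flipCmp (lexC c d)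
lexC-flip lt d = refl
lexC-flip eq d = refl
lexC-flip gt d = refl

lexC≡eq⇒ˡ : ∀ c d → lexC c d ≡ eq → c ≡ eq
lexC≡eq⇒ˡ eq d _ = refl

lexC≡eq⇒ʳ : ∀ c d → lexC c d ≡ eq → d ≡ eq
lexC≡eq⇒ʳ eq d e = e

cmpBool-flip : ∀ x y → cmpBool y x ≡ flipCmp (cmpBool x y)
cmpBool-flip false false = refl
cmpBool-flip false true  = refl
cmpBool-flip true  false = refl
cmpBool-flip true  true  = refl

cmpBool≡eq⇒≡ : ∀ x y → cmpBool x y ≡ eq → x ≡ y
cmpBool≡eq⇒≡ false false _ = refl
cmpBool≡eq⇒≡ true  true  _ = refl

cmpBool-refl : ∀ x → cmpBool x x ≡ eq
cmpBool-refl false = refl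
cmpBool-refl true  = refl

cmpVec-flip : ∀ {n} (A B : Vec Bool n) → cmpVec B A ≡ flipCmp (cmpVec A B)
cmpVec-flip []      []      = refl
cmpVec-flip (x ∷ A) (y ∷ B) rewrite cmpBool-flip x y | cmpVec-flip A B =
  lexC-flip (cmpBool x y) (cmpVec A B)

cmpVec≡eq⇒≡ : ∀ {n} (A B : Vec Bool n) → cmpVec A B ≡ eq → A ≡ B
cmpVec≡eq⇒≡ []      []      _ = refl
cmpVec≡eq⇒≡ (x ∷ A) (y ∷ B) e =
  cong₂ _∷_ (cmpBool≡eq⇒≡ x y (lexC≡eq⇒ˡ _ _ e)) (cmpVec≡eq⇒≡ A B (lexC≡eq⇒ʳ (cmpBool x y) _ e))

cmpVec-refl : ∀ {n} (A : Vec Bool n) → cmpVec A A ≡ eq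
cmpVec-refl []      = refl
cmpVec-refl (x ∷ A) rewrite cmpBool-refl x = cmpVec-refl A

module _ (s : ℕ) where

  Pair : Sort → Set
  Pair α = Sub s × Ty s α

  mutual
    cmpTy-flip : ∀ {α} (t t′ : Ty s α) → cmpTy s t′ t ≡ flipCmp (cmpTy s t t′)
    cmpTy-flip r       r         = refl
    cmpTy-flip (l ⟶ t) (l′ ⟶ t′) rewrite cmpPairs-flip l l′ | cmpTy-flip t t′ =
      lexC-flip (cmpPairs s l l′) (cmpTy s t t′)

    cmpPairs-flip : ∀ {α} (l l′ : MSet s α) → cmpPairs s l′ l ≡ flipCmp (cmpPairs s l l′)
    cmpPairs-flip []            []              = refl
    cmpPairs-flip []            (_ ∷ _)         = refl
    cmpPairs-flip (_ ∷ _)       []              = refl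
    cmpPairs-flip ((A , t) ∷ l) ((B , t′) ∷ l′)
      rewrite cmpVec-flip A B | cmpTy-flip t t′ | cmpPairs-flip l l′
            | lexC-flip (cmpVec A B) (cmpTy s t t′) =
      lexC-flip (lexC (cmpVec A B) (cmpTy s t t′)) (cmpPairs s l l′)

  mutual
    cmpTy≡eq⇒≡ : ∀ {α} (t t′ : Ty s α) → cmpTy s t t′ ≡ eq → t ≡ t′
    cmpTy≡eq⇒≡ r       r         _ = refl
    cmpTy≡eq⇒≡ (l ⟶ t) (l′ ⟶ t′) e =
      cong₂ _⟶_ (cmpPairs≡eq⇒≡ l l′ (lexC≡eq⇒ˡ _ _ e))
                (cmpTy≡eq⇒≡ t t′ (lexC≡eq⇒ʳ (cmpPairs s l l′) _ e))

    cmpPairs≡eq⇒≡ : ∀ {α} (l l′ : MSet s α) → cmpPairs s l l′ ≡ eq → l ≡ l′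
    cmpPairs≡eq⇒≡ []            []              _ = refl
    cmpPairs≡eq⇒≡ ((A , t) ∷ l) ((B , t′) ∷ l′) e =
      cong₂ _∷_ (cong₂ _,_ (cmpVec≡eq⇒≡ A B (lexC≡eq⇒ˡ _ _ head≡eq))
                           (cmpTy≡eq⇒≡ t t′ (lexC≡eq⇒ʳ (cmpVec A B) _ head≡eq)))
                (cmpPairs≡eq⇒≡ l l′ (lexC≡eq⇒ʳ (lexC (cmpVec A B) (cmpTy s t t′)) _ e))
      where
        head≡eq : lexC (cmpVec A B) (cmpTy s t t′) ≡ eq
        head≡eq = lexC≡eq⇒ˡ _ _ e

  mutual
    cmpTy-refl : ∀ {α} (t : Ty s α) → cmpTy s t t ≡ eq
    cmpTy-refl r       = refl
    cmpTy-refl (l ⟶ t) rewrite cmpPairs-refl l = cmpTy-refl t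

    cmpPairs-refl : ∀ {α} (l : MSet s α) → cmpPairs s l l ≡ eq
    cmpPairs-refl []            = refl
    cmpPairs-refl ((A , t) ∷ l) rewrite cmpVec-refl A | cmpTy-refl t = cmpPairs-refl l

  module _ {α : Sort} where

    cmpPair-flip : (x y : Pair α) → cmpPair s y x ≡ flipCmp (cmpPair s x y)
    cmpPair-flip (A , t) (B , t′) rewrite cmpVec-flip A B | cmpTy-flip t t′ =
      lexC-flip (cmpVec A B) (cmpTy s t t′)

    cmpPair≡eq⇒≡ : (x y : Pair α) → cmpPair s x y ≡ eq → x ≡ y
    cmpPair≡eq⇒≡ (A , t) (B , t′) e =
      cong₂ _,_ (cmpVec≡eq⇒≡ A B (lexC≡eq⇒ˡ _ _ e)) (cmpTy≡eq⇒≡ t t′ (lexC≡eq⇒ʳ (cmpVec A B) _ e))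

    cmpPair-refl : (x : Pair α) → cmpPair s x x ≡ eq
    cmpPair-refl (A , t) rewrite cmpVec-refl A = cmpTy-refl t

    _≟ₚ_ : DecidableEquality (Pair α)
    x ≟ₚ y with cmpPair s x y in e
    ... | eq = yes (cmpPair≡eq⇒≡ x y e)
    ... | lt = no λ { refl → lt≢eq (trans (sym e) (cmpPair-refl x)) }
      where lt≢eq : lt ≢ eq
            lt≢eq ()
    ... | gt = no λ { refl → gt≢eq (trans (sym e) (cmpPair-refl x)) }
      where gt≢eq : gt ≢ eq
            gt≢eq ()

    -- countEq s p (q ∷ l) unfolds to δ p q + countEq s p l.
    δ : Pair α → Pair α → ℕ
    δ x y = if isEq (cmpPair s x y) then 1 else 0

    δ-refl : ∀ x → δ x x ≡ 1
    δ-refl x rewrite cmpPair-refl x = refl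

    δ-≢ : ∀ x y → x ≢ y → δ x y ≡ 0
    δ-≢ x y x≢y with cmpPair s x y in e
    ... | eq = ⊥-elim (x≢y (cmpPair≡eq⇒≡ x y e))
    ... | lt = refl
    ... | gt = refl

    δ≤1 : ∀ x y → δ x y ≤ 1
    δ≤1 x y with isEq (cmpPair s x y)
    ... | true  = ≤-refl
    ... | false = z≤n

  -- Multiplicities in s-multisets

  module _ {α : Sort} where

    countEq-insert : ∀ p x (l : MSet s α) → countEq s p (insert s x l) ≡ countEq s p (x ∷ l)
    countEq-insert p x []       = refl
    countEq-insert p x (y ∷ ys) with cmpPair s x y
    ... | lt = refl
    ... | eq = refl
    ... | gt = trans (cong (δ p y +_) (countEq-insert p x ys)) (x∙yz≈y∙xz (δ p y) (δ p x) _)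

    countEq-++ : ∀ p (l l′ : MSet s α) → countEq s p (l ++ l′) ≡ countEq s p l + countEq s p l′
    countEq-++ p []      l′ = refl
    countEq-++ p (x ∷ l) l′ rewrite countEq-++ p l l′ = sym (+-assoc (δ p x) _ _)

    countEq-sortM : ∀ p (l : MSet s α) → countEq s p (sortM s l) ≡ countEq s p l
    countEq-sortM p []      = refl
    countEq-sortM p (x ∷ l) =
      trans (countEq-insert p x (sortM s l)) (cong (δ p x +_) (countEq-sortM p l))

    countEq-capGo : ∀ p (acc l : MSet s α) → countEq s p acc ≤ s →
      countEq s p (capGo s acc l) + countEq s p acc ≡ (countEq s p l + countEq s p acc) ⊓ s
    countEq-capGo p acc []       h = sym (m≤n⇒m⊓n≡m h)
    countEq-capGo p acc (x ∷ xs) h with countEq s x acc <ᵇ s in b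
    ... | true =
      trans (xy∙z≈y∙xz (δ p x) _ _)
        (trans (countEq-capGo p (x ∷ acc) xs accepted)
               (cong (_⊓ s) (sym (xy∙z≈y∙xz (δ p x) _ _))))
      where
        accepted : δ p x + countEq s p acc ≤ s
        accepted with p ≟ₚ x
        ... | yes refl rewrite δ-refl p = <ᵇ≡true⇒< _ _ b
        ... | no  p≢x  rewrite δ-≢ p x p≢x = h
    ... | false with p ≟ₚ x
    ...   | no  p≢x  rewrite δ-≢ p x p≢x = countEq-capGo p acc xs h
    ...   | yes refl rewrite δ-refl p =
      trans (countEq-capGo p acc xs h) (trans (saturated _) (sym (saturated _)))
      where
        saturated : ∀ n → (n + countEq s p acc) ⊓ s ≡ s
        saturated n = m≥n⇒m⊓n≡n (≤-trans (<ᵇ≡false⇒≥ _ _ b) (m≤n+m _ n))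

    countEq-norm : ∀ p (l : MSet s α) → countEq s p (norm s l) ≡ countEq s p l ⊓ s
    countEq-norm p l = begin
      countEq s p (sortM s (capGo s [] l))  ≡⟨ countEq-sortM p (capGo s [] l) ⟩
      countEq s p (capGo s [] l)            ≡⟨ sym (+-identityʳ _) ⟩
      countEq s p (capGo s [] l) + 0        ≡⟨ countEq-capGo p [] l z≤n ⟩
      (countEq s p l + 0) ⊓ s               ≡⟨ cong (_⊓ s) (+-identityʳ _) ⟩
      countEq s p l ⊓ s                     ∎
      where open ≡-Reasoning

    countEq-∪ₘ : ∀ p (U V : MSet s α) → countEq s p (_∪ₘ_ s U V) ≡ (countEq s p U + countEq s p V) ⊓ s
    countEq-∪ₘ p U V = trans (countEq-norm p (U ++ V)) (cong (_⊓ s) (countEq-++ p U V))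

    data Sorted : MSet s α → Set where
      []  : Sorted []
      [_] : ∀ x → Sorted (x ∷ [])
      _∷_ : ∀ {x y l} → cmpPair s x y ≢ gt → Sorted (y ∷ l) → Sorted (x ∷ y ∷ l)

    private
      ≡lt⇒≢gt : ∀ {c} → c ≡ lt → c ≢ gt
      ≡lt⇒≢gt refl ()

      ≡eq⇒≢gt : ∀ {c} → c ≡ eq → c ≢ gt
      ≡eq⇒≢gt refl ()

    cmpPair≡gt⇒flip≢gt : ∀ (x y : Pair α) → cmpPair s x y ≡ gt → cmpPair s y x ≢ gt
    cmpPair≡gt⇒flip≢gt x y e rewrite cmpPair-flip x y | e = λ ()

    insert-sorted-after : ∀ x y ys → Sorted (y ∷ ys) → cmpPair s x y ≡ gt → Sorted (y ∷ insert s x ys)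
    insert-sorted-after x y []       _             e = cmpPair≡gt⇒flip≢gt x y e ∷ [ x ]
    insert-sorted-after x y (z ∷ zs) (y≤z ∷ z∷zs) e with cmpPair s x z in e′
    ... | lt = cmpPair≡gt⇒flip≢gt x y e ∷ (≡lt⇒≢gt e′ ∷ z∷zs)
    ... | eq = cmpPair≡gt⇒flip≢gt x y e ∷ (≡eq⇒≢gt e′ ∷ z∷zs)
    ... | gt = y≤z ∷ insert-sorted-after x z zs z∷zs e′

    insert-sorted : ∀ x l → Sorted l → Sorted (insert s x l)
    insert-sorted x []       _ = [ x ]
    insert-sorted x (y ∷ ys) y∷ys with cmpPair s x y in e
    ... | lt = ≡lt⇒≢gt e ∷ y∷ys
    ... | eq = ≡eq⇒≢gt e ∷ y∷ys
    ... | gt = insert-sorted-after x y ys y∷ys e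

    sortM-sorted : ∀ l → Sorted (sortM s l)
    sortM-sorted []      = []
    sortM-sorted (x ∷ l) = insert-sorted x (sortM s l) (sortM-sorted l)

    sortM-sorted-id : ∀ l → Sorted l → sortM s l ≡ l
    sortM-sorted-id []          _           = refl
    sortM-sorted-id (x ∷ [])    _           = refl
    sortM-sorted-id (x ∷ y ∷ l) (x≤y ∷ y∷l) rewrite sortM-sorted-id (y ∷ l) y∷l
      with cmpPair s x y
    ... | lt = refl
    ... | eq = refl
    ... | gt = ⊥-elim (x≤y refl)

    1≤countEq-∷ : ∀ x (l : MSet s α) → 1 ≤ countEq s x (x ∷ l)
    1≤countEq-∷ x l rewrite δ-refl x = s≤s z≤n

    capGo-bounded-id : ∀ (acc l : MSet s α) → (∀ p → countEq s p acc + countEq s p l ≤ s) →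
                       capGo s acc l ≡ l
    capGo-bounded-id acc []       _ = refl
    capGo-bounded-id acc (x ∷ xs) h with countEq s x acc <ᵇ s in b
    ... | true  = cong (x ∷_) (capGo-bounded-id (x ∷ acc) xs λ p →
                    subst (_≤ s) (sym (xy∙z≈y∙xz (δ p x) _ _)) (h p))
    ... | false = ⊥-elim (<⇒≱ room (<ᵇ≡false⇒≥ _ _ b))
      where
        room : countEq s x acc < s
        room = ≤-trans (≤-reflexive (+-comm 1 _))
                       (≤-trans (+-monoʳ-≤ (countEq s x acc) (1≤countEq-∷ x xs)) (h x))

    Normal : MSet s α → Set
    Normal l = Sorted l × (∀ p → countEq s p l ≤ s)

    norm-normal : ∀ l → Normal (norm s l)
    norm-normal l = sortM-sorted (capGo s [] l) ,
                    λ p → subst (_≤ s) (sym (countEq-norm p l)) (m⊓n≤n _ s)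

    normal⇒norm-id : ∀ l → Normal l → norm s l ≡ l
    normal⇒norm-id l (sorted , bounded) rewrite capGo-bounded-id [] l bounded = sortM-sorted-id l sorted

    norm-idem : ∀ l → norm s (norm s l) ≡ norm s l
    norm-idem l = normal⇒norm-id _ (norm-normal l)

    module _ {P : Pair α → Set} where

      All-insert : ∀ {x l} → P x → All P l → All P (insert s x l)
      All-insert {x} {[]}     px _          = px ∷ []
      All-insert {x} {y ∷ ys} px (py ∷ pys) with cmpPair s x y
      ... | lt = px ∷ py ∷ pys
      ... | eq = px ∷ py ∷ pys
      ... | gt = py ∷ All-insert px pys

      All-sortM : ∀ {l} → All P l → All P (sortM s l)
      All-sortM []         = []
      All-sortM (px ∷ pxs) = All-insert px (All-sortM pxs)

      All-capGo : ∀ acc {l} → All P l → All P (capGo s acc l)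
      All-capGo acc []                 = []
      All-capGo acc {x ∷ _} (px ∷ pxs) with countEq s x acc <ᵇ s
      ... | true  = px ∷ All-capGo (x ∷ acc) pxs
      ... | false = All-capGo acc pxs

      All-norm : ∀ {l} → All P l → All P (norm s l)
      All-norm pl = All-sortM (All-capGo [] pl)

    length-insert : ∀ x (l : MSet s α) → length (insert s x l) ≡ suc (length l)
    length-insert x []       = refl
    length-insert x (y ∷ ys) with cmpPair s x y
    ... | lt = refl
    ... | eq = refl
    ... | gt = cong suc (length-insert x ys)

    length-sortM : ∀ (l : MSet s α) → length (sortM s l) ≡ length l
    length-sortM []      = refl
    length-sortM (x ∷ l) = trans (length-insert x (sortM s l)) (cong suc (length-sortM l))

    length-capGo≤ : ∀ (acc l : MSet s α) → length (capGo s acc l) ≤ length l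
    length-capGo≤ acc []      = z≤n
    length-capGo≤ acc (x ∷ l) with countEq s x acc <ᵇ s
    ... | true  = s≤s (length-capGo≤ (x ∷ acc) l)
    ... | false = m≤n⇒m≤1+n (length-capGo≤ acc l)

    length-∪ₘ≤ : ∀ (U V : MSet s α) → length (_∪ₘ_ s U V) ≤ length U + length V
    length-∪ₘ≤ U V = begin
      length (sortM s (capGo s [] (U ++ V)))  ≡⟨ length-sortM (capGo s [] (U ++ V)) ⟩
      length (capGo s [] (U ++ V))            ≤⟨ length-capGo≤ [] (U ++ V) ⟩
      length (U ++ V)                         ≡⟨ length-++ U ⟩
      length U + length V                     ∎
      where open ≤-Reasoning

    removeFirst : Pair α → MSet s α → MSet s α
    removeFirst x []       = []
    removeFirst x (y ∷ ys) with x ≟ₚ y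
    ... | yes _ = ys
    ... | no  _ = y ∷ removeFirst x ys

    length-removeFirst : ∀ x l → 1 ≤ countEq s x l → suc (length (removeFirst x l)) ≡ length l
    length-removeFirst x (y ∷ ys) h with x ≟ₚ y
    ... | yes _   = refl
    ... | no  x≢y rewrite δ-≢ x y x≢y = cong suc (length-removeFirst x ys h)

    countEq-removeFirst : ∀ x l → 1 ≤ countEq s x l →
      ∀ p → countEq s p (removeFirst x l) + δ p x ≡ countEq s p l
    countEq-removeFirst x (y ∷ ys) h p with x ≟ₚ y
    ... | yes refl = +-comm (countEq s p ys) (δ p x)
    ... | no  x≢y rewrite δ-≢ x y x≢y =
      trans (+-assoc (δ p y) _ _) (cong (δ p y +_) (countEq-removeFirst x ys h p))

    countEq-ext⇒length≡ : ∀ (l l′ : MSet s α) → (∀ p → countEq s p l ≡ countEq s p l′) →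
                           length l ≡ length l′
    countEq-ext⇒length≡ []       []       _ = refl
    countEq-ext⇒length≡ []       (y ∷ ys) h = ⊥-elim (1+n≰n (subst (1 ≤_) (sym (h y)) (1≤countEq-∷ y ys)))
    countEq-ext⇒length≡ (x ∷ xs) l′       h =
      trans (cong suc (countEq-ext⇒length≡ xs (removeFirst x l′) λ p →
              +-cancelʳ-≡ (δ p x) _ _
                (trans (+-comm (countEq s p xs) (δ p x)) (trans (h p) (sym (countEq-removeFirst x l′ x∈l′ p))))))
            (length-removeFirst x l′ x∈l′)
      where
        x∈l′ : 1 ≤ countEq s x l′
        x∈l′ = subst (1 ≤_) (h x) (1≤countEq-∷ x xs)

    module _ (f : Pair α → Bool) where

      countEq-filterᵇ-true : ∀ p l → f p ≡ true → countEq s p (filterᵇ f l) ≡ countEq s p l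
      countEq-filterᵇ-true p []      _ = refl
      countEq-filterᵇ-true p (x ∷ l) e with p ≟ₚ x
      ... | yes refl rewrite e | δ-refl p = cong suc (countEq-filterᵇ-true p l e)
      ... | no  p≢x with f x
      ...   | true  rewrite δ-≢ p x p≢x = countEq-filterᵇ-true p l e
      ...   | false rewrite δ-≢ p x p≢x = countEq-filterᵇ-true p l e

      countEq-filterᵇ-false : ∀ p l → f p ≡ false → countEq s p (filterᵇ f l) ≡ 0
      countEq-filterᵇ-false p []      _ = refl
      countEq-filterᵇ-false p (x ∷ l) e with p ≟ₚ x
      ... | yes refl rewrite e = countEq-filterᵇ-false p l e
      ... | no  p≢x with f x
      ...   | true  rewrite δ-≢ p x p≢x = countEq-filterᵇ-false p l e
      ...   | false = countEq-filterᵇ-false p l e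

    countEq-↭ : ∀ p {l l′ : MSet s α} → l ↭ l′ → countEq s p l ≡ countEq s p l′
    countEq-↭ p ↭.refl                 = refl
    countEq-↭ p (↭.prep x l↭l′)        = cong (δ p x +_) (countEq-↭ p l↭l′)
    countEq-↭ p (↭.swap x y l↭l′)      =
      trans (x∙yz≈y∙xz (δ p x) (δ p y) _) (cong (λ n → δ p y + (δ p x + n)) (countEq-↭ p l↭l′))
    countEq-↭ p (↭.trans l↭l′ l′↭l″) = trans (countEq-↭ p l↭l′) (countEq-↭ p l′↭l″)

    mutual
      countEq-tabulate-≥ : ∀ {k} (f : Fin k → Pair α) p {m} (g : Fin m → Fin k) →
        (∀ i j → g i ≡ g j → i ≡ j) → (∀ j → f (g j) ≡ p) → m ≤ countEq s p (tabulate f)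
      countEq-tabulate-≥ {zero}  f p {zero}  g _ _ = z≤n
      countEq-tabulate-≥ {zero}  f p {suc m} g _ _ with () ← g Fin.zero
      countEq-tabulate-≥ {suc k} f p {m}     g inj fg≡p with any? (λ j → g j Fin.≟ Fin.zero)
      ... | no  ∄j = ≤-trans (countEq-tabulate-suc-≥ f p g inj fg≡p (λ j g≡0 → ∄j (j , g≡0)))
                             (m≤n+m _ (δ p (f Fin.zero)))
      ... | yes (j₀ , gj₀≡0) with m | j₀ | g | inj | fg≡p | gj₀≡0
      ...   | suc m′ | j₀ | g | inj | fg≡p | gj₀≡0 =
        subst (λ n → suc m′ ≤ n + countEq s p (tabulate (f ∘ Fin.suc))) (sym δ≡1)
          (s≤s (countEq-tabulate-suc-≥ f p (g ∘ Fin.punchIn j₀) (λ i j e → punchIn-injective j₀ i j (inj _ _ e))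
                  (fg≡p ∘ Fin.punchIn j₀) (λ i e → punchInᵢ≢i j₀ i (inj _ _ (trans e (sym gj₀≡0))))))
        where
          δ≡1 : δ p (f Fin.zero) ≡ 1
          δ≡1 = trans (cong (δ p) (trans (cong f (sym gj₀≡0)) (fg≡p j₀))) (δ-refl p)

      countEq-tabulate-suc-≥ : ∀ {k} (f : Fin (suc k) → Pair α) p {m} (g : Fin m → Fin (suc k)) →
        (∀ i j → g i ≡ g j → i ≡ j) → (∀ j → f (g j) ≡ p) → (∀ j → g j ≢ Fin.zero) →
        m ≤ countEq s p (tabulate (f ∘ Fin.suc))
      countEq-tabulate-suc-≥ f p g inj fg≡p g≢0 =
        countEq-tabulate-≥ (f ∘ Fin.suc) p (λ j → Fin.punchOut (g≢0 j ∘ sym))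
          (λ i j e → inj i j (trans (sym (punchIn-punchOut (g≢0 i ∘ sym)))
                                    (trans (cong Fin.suc e) (punchIn-punchOut (g≢0 j ∘ sym)))))
          (λ j → trans (cong f (punchIn-punchOut (g≢0 j ∘ sym))) (fg≡p j))

  norm-singleton : 1 ≤ s → ∀ {α} (x : Pair α) → norm s (x ∷ []) ≡ x ∷ []
  norm-singleton s≥1 x =
    normal⇒norm-id (x ∷ []) ([ x ] , λ p → ≤-trans (≤-reflexive (+-identityʳ _)) (≤-trans (δ≤1 p x) s≥1))

  restrictAₘ : ∀ {α} → Fin s → MSet s α → MSet s α
  restrictAₘ a = filterᵇ (λ p → Vec.lookup (proj₁ p) a)

  ⋃ₘ : ∀ {α} → List (MSet s α) → MSet s α
  ⋃ₘ = foldr (_∪ₘ_ s) []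

  duplₘ : ∀ {α} → List (MSet s α) → Fin s → ℕ
  duplₘ Xs a = sumL s (map (λ X → length (restrictAₘ a X)) Xs) ∸ length (⋃ₘ (map (restrictAₘ a) Xs))

  length-⋃ₘ-map≤ : ∀ {α} {B : Set} (f : B → MSet s α) (bs : List B) →
                   length (⋃ₘ (map f bs)) ≤ sumL s (map (λ b → length (f b)) bs)
  length-⋃ₘ-map≤ f []       = z≤n
  length-⋃ₘ-map≤ f (b ∷ bs) = ≤-trans (length-∪ₘ≤ (f b) _) (+-monoʳ-≤ (length (f b)) (length-⋃ₘ-map≤ f bs))

  ∅∪ₑ∅ : ∀ {Δ} → _∪ₑ_ s (∅ₑ s {Δ}) (∅ₑ s) ≡ ∅ₑ s
  ∅∪ₑ∅ {[]}    = refl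
  ∅∪ₑ∅ {_ ∷ Δ} = cong ([] ∷_) ∅∪ₑ∅

  restrictA-∅ : ∀ {Δ} a → restrictA s a (∅ₑ s {Δ}) ≡ ∅ₑ s
  restrictA-∅ {[]}    a = refl
  restrictA-∅ {_ ∷ Δ} a = cong ([] ∷_) (restrictA-∅ a)

  restrict≥-∅ : ∀ {Δ} ℓ → restrict≥ s ℓ (∅ₑ s {Δ}) ≡ ∅ₑ s
  restrict≥-∅ {[]}    ℓ = refl
  restrict≥-∅ {α ∷ Δ} ℓ with ℓ ≤ᵇ ord α
  ... | true  = cong ([] ∷_) (restrict≥-∅ ℓ)
  ... | false = cong ([] ∷_) (restrict≥-∅ ℓ)

  restrict<-∅ : ∀ {Δ} ℓ → restrict< s ℓ (∅ₑ s {Δ}) ≡ ∅ₑ s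
  restrict<-∅ {[]}    ℓ = refl
  restrict<-∅ {α ∷ Δ} ℓ with ord α <ᵇ ℓ
  ... | true  = cong ([] ∷_) (restrict<-∅ ℓ)
  ... | false = cong ([] ∷_) (restrict<-∅ ℓ)

  size-∅ : ∀ {Δ} → size s (∅ₑ s {Δ}) ≡ 0
  size-∅ {[]}    = refl
  size-∅ {_ ∷ Δ} = size-∅ {Δ}

  size-∪ₑ≤ : ∀ {Δ} (G H : Env s Δ) → size s (_∪ₑ_ s G H) ≤ size s G + size s H
  size-∪ₑ≤ []      []      = z≤n
  size-∪ₑ≤ (U ∷ G) (V ∷ H) =
    ≤-trans (+-mono-≤ (length-∪ₘ≤ U V) (size-∪ₑ≤ G H))
            (≤-reflexive (interchange (length U) (length V) (size s G) (size s H)))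

  size-⋃ₑ-map≤ : ∀ {Δ} {B : Set} (f : B → Env s Δ) (bs : List B) →
                  size s (⋃ₑ s (map f bs)) ≤ sumL s (map (λ b → size s (f b)) bs)
  size-⋃ₑ-map≤ {Δ} f []       = ≤-reflexive (size-∅ {Δ})
  size-⋃ₑ-map≤     f (b ∷ bs) = ≤-trans (size-∪ₑ≤ (f b) _) (+-monoʳ-≤ (size s (f b)) (size-⋃ₑ-map≤ f bs))

  ∷-injective : ∀ {α Δ} {U V : MSet s α} {G H : Env s Δ} →
                _≡_ {A = Env s (α ∷ Δ)} (U ∷ G) (V ∷ H) → (U ≡ V) × (G ≡ H)
  ∷-injective refl = refl , refl

  -- Γ with the bindings X for the variable that sits under the binders E.
  insertₑ : ∀ {σ} (E : Ctx) {Δ} → MSet s σ → Env s (E ++ Δ) → Env s (E ++ σ ∷ Δ)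
  insertₑ []      X Γ       = X ∷ Γ
  insertₑ (γ ∷ E) X (U ∷ Γ) = U ∷ insertₑ E X Γ

  module _ {σ : Sort} where

    insertₑ-∪ₑ : ∀ E {Δ} (X Y : MSet s σ) (G H : Env s (E ++ Δ)) →
      _∪ₑ_ s (insertₑ E X G) (insertₑ E Y H) ≡ insertₑ E (_∪ₘ_ s X Y) (_∪ₑ_ s G H)
    insertₑ-∪ₑ []      X Y G       H       = refl
    insertₑ-∪ₑ (γ ∷ E) X Y (U ∷ G) (V ∷ H) = cong (_ ∷_) (insertₑ-∪ₑ E X Y G H)

    insertₑ-∅ : ∀ E {Δ} → ∅ₑ s {E ++ σ ∷ Δ} ≡ insertₑ E [] (∅ₑ s)
    insertₑ-∅ []      = refl
    insertₑ-∅ (γ ∷ E) = cong ([] ∷_) (insertₑ-∅ E)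

    restrictA-insertₑ : ∀ E {Δ} a (X : MSet s σ) (G : Env s (E ++ Δ)) →
      restrictA s a (insertₑ E X G) ≡ insertₑ E (restrictAₘ a X) (restrictA s a G)
    restrictA-insertₑ []      a X G       = refl
    restrictA-insertₑ (γ ∷ E) a X (U ∷ G) = cong (_ ∷_) (restrictA-insertₑ E a X G)

    restrict≥-insertₑ : ∀ E {Δ} ℓ → (ℓ ≤ᵇ ord σ) ≡ true → (X : MSet s σ) (G : Env s (E ++ Δ)) →
      restrict≥ s ℓ (insertₑ E X G) ≡ insertₑ E X (restrict≥ s ℓ G)
    restrict≥-insertₑ []      ℓ e X G rewrite e = refl
    restrict≥-insertₑ (γ ∷ E) ℓ e X (U ∷ G) = cong (_ ∷_) (restrict≥-insertₑ E ℓ e X G)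

    restrict<-insertₑ : ∀ E {Δ} ℓ → (ord σ <ᵇ ℓ) ≡ false → (X : MSet s σ) (G : Env s (E ++ Δ)) →
      restrict< s ℓ (insertₑ E X G) ≡ insertₑ E [] (restrict< s ℓ G)
    restrict<-insertₑ []      ℓ e X G rewrite e = refl
    restrict<-insertₑ (γ ∷ E) ℓ e X (U ∷ G) = cong (_ ∷_) (restrict<-insertₑ E ℓ e X G)

    size-insertₑ : ∀ E {Δ} (X : MSet s σ) (G : Env s (E ++ Δ)) →
      size s (insertₑ E X G) ≡ length X + size s G
    size-insertₑ []      X G       = refl
    size-insertₑ (γ ∷ E) X (U ∷ G) =
      trans (cong (length U +_) (size-insertₑ E X G)) (x∙yz≈y∙xz (length U) (length X) (size s G))

    insertₑ≡∅⇒ : ∀ E {Δ} (X : MSet s σ) (G : Env s (E ++ Δ)) →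
      insertₑ E X G ≡ ∅ₑ s → (X ≡ []) × (G ≡ ∅ₑ s)
    insertₑ≡∅⇒ []      X G       refl = refl , refl
    insertₑ≡∅⇒ (γ ∷ E) X (U ∷ G) e with ∷-injective e
    ... | U≡[] , G′≡∅ with insertₑ≡∅⇒ E X G G′≡∅
    ...   | X≡[] , G≡∅ = X≡[] , cong₂ _∷_ U≡[] G≡∅

    module _ (E : Ctx) {Δ : Ctx} where

      private
        insertPair : MSet s σ × Env s (E ++ Δ) → Env s (E ++ σ ∷ Δ)
        insertPair = uncurry (insertₑ E)

      ⋃ₑ-insertₑ : ∀ zs → ⋃ₑ s (map insertPair zs) ≡ insertₑ E (⋃ₘ (map proj₁ zs)) (⋃ₑ s (map proj₂ zs))
      ⋃ₑ-insertₑ []             = insertₑ-∅ E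
      ⋃ₑ-insertₑ ((X , G) ∷ zs) =
        trans (cong (_∪ₑ_ s (insertₑ E X G)) (⋃ₑ-insertₑ zs)) (insertₑ-∪ₑ E _ _ _ _)

      dupl-insertₑ : ∀ a zs → dupl s (map insertPair zs) a ≡ duplₘ (map proj₁ zs) a + dupl s (map proj₂ zs) a
      dupl-insertₑ a zs = begin
        sumL s (map (λ G → size s (restrictA s a G)) (map insertPair zs)) ∸ size s (⋃ₑ s (map (restrictA s a) (map insertPair zs)))
          ≡⟨ cong₂ _∸_ (sum-split zs) (trans (cong (size s) (union-split zs)) (size-insertₑ E _ _)) ⟩
        (ΣX + ΣG) ∸ (length (⋃ₘ (map (restrictAₘ a) (map proj₁ zs))) + size s (⋃ₑ s (map (restrictA s a) (map proj₂ zs))))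
          ≡⟨ [m+n]∸[j+k]≡[m∸j]+[n∸k] ΣX ΣG _ _ (length-⋃ₘ-map≤ (restrictAₘ a) (map proj₁ zs))
                                               (size-⋃ₑ-map≤ (restrictA s a) (map proj₂ zs)) ⟩
        duplₘ (map proj₁ zs) a + dupl s (map proj₂ zs) a ∎
        where
          open ≡-Reasoning
          ΣX ΣG : ℕ
          ΣX = sumL s (map (λ X → length (restrictAₘ a X)) (map proj₁ zs))
          ΣG = sumL s (map (λ G → size s (restrictA s a G)) (map proj₂ zs))

          sum-split : ∀ zs → sumL s (map (λ G → size s (restrictA s a G)) (map insertPair zs)) ≡
                             sumL s (map (λ X → length (restrictAₘ a X)) (map proj₁ zs)) +
                             sumL s (map (λ G → size s (restrictA s a G)) (map proj₂ zs))
          sum-split []             = refl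
          sum-split ((X , G) ∷ zs) =
            trans (cong₂ _+_ (trans (cong (size s) (restrictA-insertₑ E a X G)) (size-insertₑ E _ _)) (sum-split zs))
                  (interchange (length (restrictAₘ a X)) (size s (restrictA s a G)) _ _)

          union-split : ∀ zs → ⋃ₑ s (map (restrictA s a) (map insertPair zs)) ≡
            insertₑ E (⋃ₘ (map (restrictAₘ a) (map proj₁ zs))) (⋃ₑ s (map (restrictA s a) (map proj₂ zs)))
          union-split []             = insertₑ-∅ E
          union-split ((X , G) ∷ zs) =
            trans (cong₂ (_∪ₑ_ s) (restrictA-insertₑ E a X G) (union-split zs)) (insertₑ-∪ₑ E _ _ _ _)

  module _ {E : Ctx} where

    padₑ : ∀ {F} → Env s F → Env s (F ++ E)
    padₑ []      = ∅ₑ s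
    padₑ (U ∷ G) = U ∷ padₑ G

    padₑ-∪ₑ : ∀ {F} (G H : Env s F) → _∪ₑ_ s (padₑ G) (padₑ H) ≡ padₑ (_∪ₑ_ s G H)
    padₑ-∪ₑ []      []      = ∅∪ₑ∅
    padₑ-∪ₑ (U ∷ G) (V ∷ H) = cong (_ ∷_) (padₑ-∪ₑ G H)

    padₑ-∅ : ∀ {F} → ∅ₑ s {F ++ E} ≡ padₑ (∅ₑ s)
    padₑ-∅ {[]}    = refl
    padₑ-∅ {_ ∷ F} = cong ([] ∷_) (padₑ-∅ {F})

    restrictA-padₑ : ∀ {F} a (G : Env s F) → restrictA s a (padₑ G) ≡ padₑ (restrictA s a G)
    restrictA-padₑ a []      = restrictA-∅ a
    restrictA-padₑ a (U ∷ G) = cong (_ ∷_) (restrictA-padₑ a G)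

    restrict≥-padₑ : ∀ {F} ℓ (G : Env s F) → restrict≥ s ℓ (padₑ G) ≡ padₑ (restrict≥ s ℓ G)
    restrict≥-padₑ ℓ []      = restrict≥-∅ ℓ
    restrict≥-padₑ ℓ (U ∷ G) = cong (_ ∷_) (restrict≥-padₑ ℓ G)

    restrict<-padₑ : ∀ {F} ℓ (G : Env s F) → restrict< s ℓ (padₑ G) ≡ padₑ (restrict< s ℓ G)
    restrict<-padₑ ℓ []      = restrict<-∅ ℓ
    restrict<-padₑ ℓ (U ∷ G) = cong (_ ∷_) (restrict<-padₑ ℓ G)

    size-padₑ : ∀ {F} (G : Env s F) → size s (padₑ G) ≡ size s G
    size-padₑ []      = size-∅ {E}
    size-padₑ (U ∷ G) = cong (length U +_) (size-padₑ G)

    padₑ≡∅⇒ : ∀ {F} (G : Env s F) → padₑ G ≡ ∅ₑ s → G ≡ ∅ₑ s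
    padₑ≡∅⇒ []      _ = refl
    padₑ≡∅⇒ (U ∷ G) e with ∷-injective e
    ... | U≡[] , G′≡∅ = cong₂ _∷_ U≡[] (padₑ≡∅⇒ G G′≡∅)

    singleₑ-injectV : ∀ {F β} (v : Var F β) p → singleₑ s (injectV s E v) p ≡ padₑ (singleₑ s v p)
    singleₑ-injectV here      p = cong ((p ∷ []) ∷_) padₑ-∅
    singleₑ-injectV (there v) p = cong ([] ∷_) (singleₑ-injectV v p)

    ⋃ₑ-padₑ : ∀ {F} (Gs : List (Env s F)) → ⋃ₑ s (map padₑ Gs) ≡ padₑ (⋃ₑ s Gs)
    ⋃ₑ-padₑ []       = padₑ-∅
    ⋃ₑ-padₑ (G ∷ Gs) = trans (cong (_∪ₑ_ s (padₑ G)) (⋃ₑ-padₑ Gs)) (padₑ-∪ₑ G _)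

    dupl-padₑ : ∀ {F} (Gs : List (Env s F)) a → dupl s (map padₑ Gs) a ≡ dupl s Gs a
    dupl-padₑ {F} Gs a =
      cong₂ _∸_ (sum-pad Gs) (trans (cong (size s) (union-pad Gs)) (size-padₑ (⋃ₑ s (map (restrictA s a) Gs))))
      where
        sum-pad : ∀ Gs → sumL s (map (λ G → size s (restrictA s a G)) (map padₑ Gs)) ≡
                         sumL s (map (λ G → size s (restrictA s a G)) Gs)
        sum-pad []       = refl
        sum-pad (G ∷ Gs) =
          cong₂ _+_ (trans (cong (size s) (restrictA-padₑ a G)) (size-padₑ (restrictA s a G))) (sum-pad Gs)

        union-pad : ∀ Gs → ⋃ₑ s (map (restrictA s a) (map padₑ Gs)) ≡ padₑ (⋃ₑ s (map (restrictA s a) Gs))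
        union-pad []       = padₑ-∅
        union-pad (G ∷ Gs) =
          trans (cong₂ (_∪ₑ_ s) (restrictA-padₑ a G) (union-pad Gs)) (padₑ-∪ₑ (restrictA s a G) _)

  ∑-cong : ∀ {k} {f g : Fin k → ℕ} → (∀ i → f i ≡ g i) → ∑ s f ≡ ∑ s g
  ∑-cong {zero}  h = refl
  ∑-cong {suc k} h = cong₂ _+_ (h Fin.zero) (∑-cong (h ∘ Fin.suc))

  ∑-+ : ∀ {k} (f g : Fin k → ℕ) → ∑ s (λ i → f i + g i) ≡ ∑ s f + ∑ s g
  ∑-+ {zero}  f g = refl
  ∑-+ {suc k} f g rewrite ∑-+ (f ∘ Fin.suc) (g ∘ Fin.suc) = interchange (f Fin.zero) (g Fin.zero) _ _

  ∑-zero : ∀ {k} (f : Fin k → ℕ) → (∀ i → f i ≡ 0) → ∑ s f ≡ 0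
  ∑-zero {zero}  f h = refl
  ∑-zero {suc k} f h rewrite h Fin.zero = ∑-zero (f ∘ Fin.suc) (h ∘ Fin.suc)

  ∑-⊓ : ∀ {k} (f : Fin k → ℕ) → ∑ s (λ i → f i ⊓ s) ⊓ s ≡ ∑ s f ⊓ s
  ∑-⊓ {zero}  f = refl
  ∑-⊓ {suc k} f = begin
    (f₀ ⊓ s + ∑ s (λ i → f (Fin.suc i) ⊓ s)) ⊓ s      ≡⟨ cong (_⊓ s) (+-comm (f₀ ⊓ s) _) ⟩
    (∑ s (λ i → f (Fin.suc i) ⊓ s) + f₀ ⊓ s) ⊓ s      ≡⟨ m+n⊓k⊓k≡m+n⊓k _ f₀ s ⟩
    (∑ s (λ i → f (Fin.suc i) ⊓ s) + f₀) ⊓ s          ≡⟨ cong (_⊓ s) (+-comm _ f₀) ⟩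
    (f₀ + ∑ s (λ i → f (Fin.suc i) ⊓ s)) ⊓ s          ≡⟨ m+n⊓k⊓k≡m+n⊓k f₀ _ s ⟨
    (f₀ + ∑ s (λ i → f (Fin.suc i) ⊓ s) ⊓ s) ⊓ s      ≡⟨ cong (λ n → (f₀ + n) ⊓ s) (∑-⊓ (f ∘ Fin.suc)) ⟩
    (f₀ + ∑ s (f ∘ Fin.suc) ⊓ s) ⊓ s                   ≡⟨ m+n⊓k⊓k≡m+n⊓k f₀ _ s ⟩
    (f₀ + ∑ s (f ∘ Fin.suc)) ⊓ s                       ∎
    where
      open ≡-Reasoning
      f₀ : ℕ
      f₀ = f Fin.zero

  sumL-map-tabulate : ∀ {A : Set} {k} (f : A → ℕ) (g : Fin k → A) → sumL s (map f (tabulate g)) ≡ ∑ s (f ∘ g)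
  sumL-map-tabulate {k = zero}  f g = refl
  sumL-map-tabulate {k = suc k} f g = cong (f (g Fin.zero) +_) (sumL-map-tabulate f (g ∘ Fin.suc))

  ∑-concat : ∀ {A : Set} (f : List A → ℕ) → f [] ≡ 0 → (∀ l l′ → f (l ++ l′) ≡ f l + f l′) →
             ∀ {k} (Ls : Fin k → List A) → f (concat (tabulate Ls)) ≡ ∑ s (f ∘ Ls)
  ∑-concat f f[] f++ {zero}  Ls = f[]
  ∑-concat f f[] f++ {suc k} Ls =
    trans (f++ (Ls Fin.zero) _) (cong (f (Ls Fin.zero) +_) (∑-concat f f[] f++ (Ls ∘ Fin.suc)))

  countEq-⋃ₘ : ∀ {α} p (Xs : List (MSet s α)) → countEq s p (⋃ₘ Xs) ≡ sumL s (map (countEq s p) Xs) ⊓ s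
  countEq-⋃ₘ p []       = refl
  countEq-⋃ₘ p (X ∷ Xs) =
    trans (countEq-∪ₘ p X _)
          (trans (cong (λ n → (countEq s p X + n) ⊓ s) (countEq-⋃ₘ p Xs)) (m+n⊓k⊓k≡m+n⊓k (countEq s p X) _ s))

  length-restrictAₘ-++ : ∀ {α} a (X Y : MSet s α) →
                         length (restrictAₘ a (X ++ Y)) ≡ length (restrictAₘ a X) + length (restrictAₘ a Y)
  length-restrictAₘ-++ a []      Y = refl
  length-restrictAₘ-++ a (p ∷ X) Y with Vec.lookup (proj₁ p) a
  ... | true  = cong suc (length-restrictAₘ-++ a X Y)
  ... | false = length-restrictAₘ-++ a X Y

  length-⋃ₘ-restrictAₘ : ∀ {α} a (Xs : List (MSet s α)) →
    length (⋃ₘ (map (restrictAₘ a) Xs)) ≡ length (restrictAₘ a (⋃ₘ Xs))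
  length-⋃ₘ-restrictAₘ {α} a Xs = countEq-ext⇒length≡ (⋃ₘ (map (restrictAₘ a) Xs)) (restrictAₘ a (⋃ₘ Xs)) λ p →
    trans (countEq-⋃ₘ p (map (restrictAₘ a) Xs)) (by-membership p (Vec.lookup (proj₁ p) a) refl)
    where
      a∈_ : Pair α → Bool
      a∈ q = Vec.lookup (proj₁ q) a

      sum-restrict-true : ∀ p Xs → a∈ p ≡ true → sumL s (map (countEq s p) (map (restrictAₘ a) Xs)) ≡ sumL s (map (countEq s p) Xs)
      sum-restrict-true p []       e = refl
      sum-restrict-true p (X ∷ Xs) e = cong₂ _+_ (countEq-filterᵇ-true a∈_ p X e) (sum-restrict-true p Xs e)

      sum-restrict-false : ∀ p Xs → a∈ p ≡ false → sumL s (map (countEq s p) (map (restrictAₘ a) Xs)) ≡ 0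
      sum-restrict-false p []       e = refl
      sum-restrict-false p (X ∷ Xs) e = cong₂ _+_ (countEq-filterᵇ-false a∈_ p X e) (sum-restrict-false p Xs e)

      by-membership : ∀ p b → a∈ p ≡ b →
        sumL s (map (countEq s p) (map (restrictAₘ a) Xs)) ⊓ s ≡ countEq s p (restrictAₘ a (⋃ₘ Xs))
      by-membership p true  e = trans (cong (_⊓ s) (sum-restrict-true p Xs e))
                                      (trans (sym (countEq-⋃ₘ p Xs)) (sym (countEq-filterᵇ-true a∈_ p (⋃ₘ Xs) e)))
      by-membership p false e = trans (cong (_⊓ s) (sum-restrict-false p Xs e)) (sym (countEq-filterᵇ-false a∈_ p (⋃ₘ Xs) e))

  module _ {σ : Sort} (E : Ctx) {Δ : Ctx} {k : ℕ} (X₀ : MSet s σ) (Xs : Fin k → MSet s σ) where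

    private
      components : Env s (E ++ Δ) → (Fin k → Env s (E ++ Δ)) → List (MSet s σ × Env s (E ++ Δ))
      components Γ₀ Γs = (X₀ , Γ₀) ∷ tabulate (λ i → Xs i , Γs i)

      map-components : ∀ {B : Set} (f : MSet s σ × Env s (E ++ Δ) → B) Γ₀ Γs →
        map f (components Γ₀ Γs) ≡ f (X₀ , Γ₀) ∷ tabulate (λ i → f (Xs i , Γs i))
      map-components f Γ₀ Γs = cong (_ ∷_) (map-tabulate (λ i → Xs i , Γs i) f)

    ⋃ₑ-insertₑ-family : ∀ Γ₀ Γs →
      ⋃ₑ s (insertₑ E X₀ Γ₀ ∷ tabulate (λ i → insertₑ E (Xs i) (Γs i))) ≡
      insertₑ E (⋃ₘ (X₀ ∷ tabulate Xs)) (⋃ₑ s (Γ₀ ∷ tabulate Γs))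
    ⋃ₑ-insertₑ-family Γ₀ Γs = begin
      ⋃ₑ s (insertₑ E X₀ Γ₀ ∷ tabulate (λ i → insertₑ E (Xs i) (Γs i)))
        ≡⟨ cong (⋃ₑ s) (map-components (uncurry (insertₑ E)) Γ₀ Γs) ⟨
      ⋃ₑ s (map (uncurry (insertₑ E)) (components Γ₀ Γs))
        ≡⟨ ⋃ₑ-insertₑ E (components Γ₀ Γs) ⟩
      insertₑ E (⋃ₘ (map proj₁ (components Γ₀ Γs))) (⋃ₑ s (map proj₂ (components Γ₀ Γs)))
        ≡⟨ cong₂ (λ Ys Gs → insertₑ E (⋃ₘ Ys) (⋃ₑ s Gs)) (map-components proj₁ Γ₀ Γs) (map-components proj₂ Γ₀ Γs) ⟩
      insertₑ E (⋃ₘ (X₀ ∷ tabulate Xs)) (⋃ₑ s (Γ₀ ∷ tabulate Γs)) ∎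
      where open ≡-Reasoning

    dupl-insertₑ-family : ∀ Γ₀ Γs a →
      dupl s (insertₑ E X₀ Γ₀ ∷ tabulate (λ i → insertₑ E (Xs i) (Γs i))) a ≡
      duplₘ (X₀ ∷ tabulate Xs) a + dupl s (Γ₀ ∷ tabulate Γs) a
    dupl-insertₑ-family Γ₀ Γs a = begin
      dupl s (insertₑ E X₀ Γ₀ ∷ tabulate (λ i → insertₑ E (Xs i) (Γs i))) a
        ≡⟨ cong (λ Gs → dupl s Gs a) (map-components (uncurry (insertₑ E)) Γ₀ Γs) ⟨
      dupl s (map (uncurry (insertₑ E)) (components Γ₀ Γs)) a
        ≡⟨ dupl-insertₑ E a (components Γ₀ Γs) ⟩
      duplₘ (map proj₁ (components Γ₀ Γs)) a + dupl s (map proj₂ (components Γ₀ Γs)) a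
        ≡⟨ cong₂ (λ Ys Gs → duplₘ Ys a + dupl s Gs a) (map-components proj₁ Γ₀ Γs) (map-components proj₂ Γ₀ Γs) ⟩
      duplₘ (X₀ ∷ tabulate Xs) a + dupl s (Γ₀ ∷ tabulate Γs) a ∎
      where open ≡-Reasoning

  restrict≥-∪ₑ : ∀ ℓ {Δ} (G H : Env s Δ) →
                 restrict≥ s ℓ (_∪ₑ_ s G H) ≡ _∪ₑ_ s (restrict≥ s ℓ G) (restrict≥ s ℓ H)
  restrict≥-∪ₑ ℓ []              []      = refl
  restrict≥-∪ₑ ℓ (_∷_ {β} U G) (V ∷ H) with ℓ ≤ᵇ ord β
  ... | true  = cong (_ ∷_) (restrict≥-∪ₑ ℓ G H)
  ... | false = cong ([] ∷_) (restrict≥-∪ₑ ℓ G H)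

  restrict≥-⋃ₑ : ∀ ℓ {Δ} (Gs : List (Env s Δ)) → restrict≥ s ℓ (⋃ₑ s Gs) ≡ ⋃ₑ s (map (restrict≥ s ℓ) Gs)
  restrict≥-⋃ₑ ℓ []       = restrict≥-∅ ℓ
  restrict≥-⋃ₑ ℓ (G ∷ Gs) = trans (restrict≥-∪ₑ ℓ G _) (cong (_∪ₑ_ s (restrict≥ s ℓ G)) (restrict≥-⋃ₑ ℓ Gs))

  ⋃ₑ-all-∅ : ∀ {Δ} (Gs : List (Env s Δ)) → All (_≡ ∅ₑ s) Gs → ⋃ₑ s Gs ≡ ∅ₑ s
  ⋃ₑ-all-∅ []       []          = refl
  ⋃ₑ-all-∅ (G ∷ Gs) (refl ∷ es) rewrite ⋃ₑ-all-∅ Gs es = ∅∪ₑ∅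

  dupl-all-∅ : ∀ {Δ} (Gs : List (Env s Δ)) a → All (_≡ ∅ₑ s) Gs → dupl s Gs a ≡ 0
  dupl-all-∅ {Δ} Gs a es = cong₂ _∸_ (sum-∅ Gs es) (trans (cong (size s) (⋃ₑ-all-∅ _ (restrict-∅ Gs es))) (size-∅ {Δ}))
    where
      sum-∅ : ∀ Gs → All (_≡ ∅ₑ s) Gs → sumL s (map (λ G → size s (restrictA s a G)) Gs) ≡ 0
      sum-∅ []       []          = refl
      sum-∅ (G ∷ Gs) (refl ∷ es) rewrite restrictA-∅ {Δ} a | size-∅ {Δ} = sum-∅ Gs es

      restrict-∅ : ∀ Gs → All (_≡ ∅ₑ s) Gs → All (_≡ ∅ₑ s) (map (restrictA s a) Gs)
      restrict-∅ []       []          = []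
      restrict-∅ (G ∷ Gs) (refl ∷ es) = restrictA-∅ a ∷ restrict-∅ Gs es

  restrict≥-singleₑ : ∀ ℓ {Δ β} (v : Var Δ β) p → ¬ (ℓ ≤ ord β) → restrict≥ s ℓ (singleₑ s v p) ≡ ∅ₑ s
  restrict≥-singleₑ ℓ {β = β} here p ℓ≰β with ℓ ≤ᵇ ord β in e
  ... | true  = ⊥-elim (ℓ≰β (≤ᵇ⇒≤ ℓ (ord β) (subst T (sym e) tt)))
  ... | false = cong ([] ∷_) (restrict≥-∅ ℓ)
  restrict≥-singleₑ ℓ (there {β = γ} v) p ℓ≰β with ℓ ≤ᵇ ord γ
  ... | true  = cong ([] ∷_) (restrict≥-singleₑ ℓ v p ℓ≰β)
  ... | false = cong ([] ∷_) (restrict≥-singleₑ ℓ v p ℓ≰β)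

  module _ (s≥1 : 1 ≤ s) where

    -- Canonicity is a side condition of the variable rule, needed to reuse the types derived for N.
    CanonEnv : ∀ {Δ} → Env s Δ → Set
    CanonEnv []      = ⊤
    CanonEnv (U ∷ G) = (norm s U ≡ U) × All (λ p → Canon s (proj₂ p)) U × CanonEnv G

    canon-∅ : ∀ {Δ} → CanonEnv (∅ₑ s {Δ})
    canon-∅ {[]}    = tt
    canon-∅ {_ ∷ Δ} = refl , [] , canon-∅

    canon-singleₑ : ∀ {Δ β} (v : Var Δ β) A {τ} → Canon s τ → CanonEnv (singleₑ s v (A , τ))
    canon-singleₑ here      A c = norm-singleton s≥1 _ , c ∷ [] , canon-∅
    canon-singleₑ (there v) A c = refl , [] , canon-singleₑ v A c

    canon-∪ₑ : ∀ {Δ} (G H : Env s Δ) → CanonEnv G → CanonEnv H → CanonEnv (_∪ₑ_ s G H)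
    canon-∪ₑ []      []      _               _               = tt
    canon-∪ₑ (U ∷ G) (V ∷ H) (_ , cU , cG) (_ , cV , cH) =
      norm-idem (U ++ V) , All-norm (++⁺ cU cV) , canon-∪ₑ G H cG cH

    canon-⋃ₑ : ∀ {Δ} (Gs : List (Env s Δ)) → All CanonEnv Gs → CanonEnv (⋃ₑ s Gs)
    canon-⋃ₑ []       []         = canon-∅
    canon-⋃ₑ (G ∷ Gs) (cG ∷ cGs) = canon-∪ₑ G _ cG (canon-⋃ₑ Gs cGs)

    J⇒canon : ∀ {ℓ} {S : Sys s} {Δ β} {Γ : Env s Δ} {z : St S Δ β} {u w τ} →
              J s S ℓ Γ z u w τ → CanonEnv Γ × Canon s τ
    J⇒canon (j-a _ _ _)  = canon-∅ , canon-⟶ (canon-r ∷ []) canon-r (norm-singleton s≥1 _)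
    J⇒canon (j-c _ _ _)  = canon-∅ , canon-r
    J⇒canon (j-b₁ _ _ _) = canon-∅ , canon-⟶ (canon-r ∷ []) (canon-⟶ [] canon-r refl) (norm-singleton s≥1 _)
    J⇒canon (j-b₂ _ _ _) = canon-∅ , canon-⟶ [] (canon-⟶ (canon-r ∷ []) canon-r (norm-singleton s≥1 _)) refl
    J⇒canon (j-var {v = v} {A = A} _ c _ _) = canon-singleₑ v A c , c
    J⇒canon (j-lam _ D) with J⇒canon D
    ... | (nU , cU , cΓ) , cτ = cΓ , canon-⟶ cU cτ nU
    J⇒canon (j-app _ Γ₀ _ _ DK Γs _ _ DL _ _ _) with J⇒canon DK
    ... | cΓ₀ , canon-⟶ _ cτ _ =
      canon-⋃ₑ (Γ₀ ∷ tabulate Γs) (cΓ₀ ∷ tabulate⁺ (λ i → proj₁ (J⇒canon (DL i)))) , cτ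

  module _ {ℓ : ℕ} {S : Sys s} where

    J-resp-≗ : ∀ {Δ β} {Γ : Env s Δ} {z : St S Δ β} {u w u′ w′ τ} →
               J s S ℓ Γ z u w τ → (∀ a → u a ≡ u′ a) → (∀ a → w a ≡ w′ a) → J s S ℓ Γ z u′ w′ τ
    J-resp-≗ (j-a e hu hw)     p q = j-a e (λ a → trans (sym (p a)) (hu a)) (λ a → trans (sym (q a)) (hw a))
    J-resp-≗ (j-c e hu hw)     p q = j-c e (λ a → trans (sym (p a)) (hu a)) (λ a → trans (sym (q a)) (hw a))
    J-resp-≗ (j-b₁ e hu hw)    p q = j-b₁ e (λ a → trans (sym (p a)) (hu a)) (λ a → trans (sym (q a)) (hw a))
    J-resp-≗ (j-b₂ e hu hw)    p q = j-b₂ e (λ a → trans (sym (p a)) (hu a)) (λ a → trans (sym (q a)) (hw a))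
    J-resp-≗ (j-var e c hu hw) p q = j-var e c (λ a → trans (sym (p a)) (hu a)) (λ a → trans (sym (q a)) (hw a))
    J-resp-≗ (j-lam e D)       p q = j-lam e (J-resp-≗ D p q)
    J-resp-≗ (j-app e Γ₀ u₀ w₀ DK Γs us ws DL hA hu hw) p q =
      j-app e Γ₀ u₀ w₀ DK Γs us ws DL hA (λ a → trans (sym (p a)) (hu a)) (λ a → trans (sym (q a)) (hw a))

    ¬Occ⇒lowOrder : ∀ {F β} {Γ : Env s F} {u w τ} (z : St S F β) → ¬ Occ s S ℓ z → J s S ℓ Γ z u w τ →
                    (restrict≥ s ℓ Γ ≡ ∅ₑ s) × (∀ a → u a ≡ 0)
    ¬Occ⇒lowOrder z _ (j-a _ hu _)  = restrict≥-∅ ℓ , hu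
    ¬Occ⇒lowOrder z _ (j-c _ hu _)  = restrict≥-∅ ℓ , hu
    ¬Occ⇒lowOrder z _ (j-b₁ _ hu _) = restrict≥-∅ ℓ , hu
    ¬Occ⇒lowOrder z _ (j-b₂ _ hu _) = restrict≥-∅ ℓ , hu
    ¬Occ⇒lowOrder z ¬occ (j-var {v = v} e _ hu _) = restrict≥-singleₑ ℓ v _ (λ le → ¬occ (occ-var e le)) , hu
    ¬Occ⇒lowOrder z ¬occ (j-lam {y = y} e D) with ¬Occ⇒lowOrder y (λ o → ¬occ (occ-lam e o)) D
    ... | Γ′≡∅ , u≡0 = proj₂ (∷-injective Γ′≡∅) , u≡0
    ¬Occ⇒lowOrder {F} z ¬occ (j-app {K = K} {L = L} e Γ₀ u₀ w₀ DK Γs us ws DL _ hu _) =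
      trans (restrict≥-⋃ₑ ℓ Gs) (⋃ₑ-all-∅ _ all-∅) , λ a →
        trans (hu a) (cong₂ _+_ (dupl-all-∅ _ a all-∅)
                                (cong₂ _+_ (proj₂ lowK a) (∑-zero _ (λ i → proj₂ (lowL i) a))))
      where
        lowK : (restrict≥ s ℓ Γ₀ ≡ ∅ₑ s) × (∀ a → u₀ a ≡ 0)
        lowK = ¬Occ⇒lowOrder K (λ o → ¬occ (occ-appL e o)) DK
        lowL : ∀ i → (restrict≥ s ℓ (Γs i) ≡ ∅ₑ s) × (∀ a → us i a ≡ 0)
        lowL i = ¬Occ⇒lowOrder L (λ o → ¬occ (occ-appR e o)) (DL i)
        Gs : List (Env s F)
        Gs = Γ₀ ∷ tabulate Γs
        all-∅ : All (_≡ ∅ₑ s) (map (restrict≥ s ℓ) Gs)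
        all-∅ = proj₁ lowK ∷ subst (All (_≡ ∅ₑ s)) (sym (map-tabulate Γs (restrict≥ s ℓ)))
                                     (tabulate⁺ (λ i → proj₁ (lowL i)))

  -- Copies of N in M[N/x]

  module CopiesOfN {Δ σ α} (M : Term s (σ ∷ Δ) α) (N : Term s [] σ) where

    open Subst s M N

    module _ {E : Ctx} {F : Ctx} where

      liftN≡cA⇒ : ∀ (nd : NodeF s (St SN) F (o ⇒ o)) {i} → liftN E nd ≡ cA i → nd ≡ cA i
      liftN≡cA⇒ (cA i)    refl = refl
      liftN≡cA⇒ (var v)   ()
      liftN≡cA⇒ (app K L) ()
      liftN≡cA⇒ (lam y)   ()

      liftN≡cB⇒ : ∀ (nd : NodeF s (St SN) F (o ⇒ o ⇒ o)) → liftN E nd ≡ cB → nd ≡ cB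
      liftN≡cB⇒ cB        refl = refl
      liftN≡cB⇒ (var v)   ()
      liftN≡cB⇒ (app K L) ()
      liftN≡cB⇒ (lam y)   ()

      liftN≡cC⇒ : ∀ (nd : NodeF s (St SN) F o) → liftN E nd ≡ cC → nd ≡ cC
      liftN≡cC⇒ cC        refl = refl
      liftN≡cC⇒ (var v)   ()
      liftN≡cC⇒ (app K L) ()
      liftN≡cC⇒ cΩ        ()

      liftN≡var⇒ : ∀ {β} (nd : NodeF s (St SN) F β) {v} → liftN E nd ≡ var v →
                   Σ (Var F β) λ v₀ → (nd ≡ var v₀) × (v ≡ injectV s E v₀)
      liftN≡var⇒ (var v₀)  refl = v₀ , refl , refl
      liftN≡var⇒ (lam y)   ()
      liftN≡var⇒ (app K L) ()
      liftN≡var⇒ (cA i)    ()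
      liftN≡var⇒ cB        ()
      liftN≡var⇒ cC        ()
      liftN≡var⇒ cΩ        ()

      liftN≡lam⇒ : ∀ {γ β} (nd : NodeF s (St SN) F (γ ⇒ β)) {y} → liftN E nd ≡ lam y →
                   Σ (St SN (γ ∷ F) β) λ y₀ → (nd ≡ lam y₀) × (y ≡ inN (γ ∷ F) E refl y₀)
      liftN≡lam⇒ (lam y₀)  refl = y₀ , refl , refl
      liftN≡lam⇒ (var v)   ()
      liftN≡lam⇒ (app K L) ()
      liftN≡lam⇒ (cA i)    ()
      liftN≡lam⇒ cB        ()

      liftN≡app⇒ : ∀ {γ β} (nd : NodeF s (St SN) F β) {K : St' (F ++ E) (γ ⇒ β)} {L} → liftN E nd ≡ app K L →
                   Σ (St SN F (γ ⇒ β)) λ K₀ → Σ (St SN F γ) λ L₀ →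
                     (nd ≡ app K₀ L₀) × (K ≡ inN F E refl K₀) × (L ≡ inN F E refl L₀)
      liftN≡app⇒ (app K₀ L₀) refl = K₀ , L₀ , refl , refl , refl
      liftN≡app⇒ (var v)     ()
      liftN≡app⇒ (lam y)     ()
      liftN≡app⇒ (cA i)      ()
      liftN≡app⇒ cB          ()
      liftN≡app⇒ cC          ()
      liftN≡app⇒ cΩ          ()

      restrictA-padₑ≢∅ : ∀ a (G : Env s F) → (restrictA s a (padₑ {E} G) ≢ ∅ₑ s) ⇔ (restrictA s a G ≢ ∅ₑ s)
      restrictA-padₑ≢∅ a G =
        mk⇔ (λ ne e → ne (trans (restrictA-padₑ a G) (trans (cong padₑ e) (sym (padₑ-∅ {E} {F})))))
            (λ ne e → ne (padₑ≡∅⇒ (restrictA s a G) (trans (sym (restrictA-padₑ a G)) e)))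

      dupl-restrict≥-padₑ : ∀ ℓ (Gs : List (Env s F)) a →
        dupl s (map (restrict≥ s ℓ) (map (padₑ {E}) Gs)) a ≡ dupl s (map (restrict≥ s ℓ) Gs) a
      dupl-restrict≥-padₑ ℓ Gs a =
        trans (cong (λ Hs → dupl s Hs a) (map-restrict≥ Gs)) (dupl-padₑ (map (restrict≥ s ℓ) Gs) a)
        where
          map-restrict≥ : ∀ Gs → map (restrict≥ s ℓ) (map (padₑ {E}) Gs) ≡ map padₑ (map (restrict≥ s ℓ) Gs)
          map-restrict≥ []       = refl
          map-restrict≥ (G ∷ Gs) = cong₂ _∷_ (restrict≥-padₑ ℓ G) (map-restrict≥ Gs)

      dupl-restrict<-padₑ : ∀ ℓ (Gs : List (Env s F)) a →
        dupl s (map (restrict< s ℓ) (map (padₑ {E}) Gs)) a ≡ dupl s (map (restrict< s ℓ) Gs) a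
      dupl-restrict<-padₑ ℓ Gs a =
        trans (cong (λ Hs → dupl s Hs a) (map-restrict< Gs)) (dupl-padₑ (map (restrict< s ℓ) Gs) a)
        where
          map-restrict< : ∀ Gs → map (restrict< s ℓ) (map (padₑ {E}) Gs) ≡ map padₑ (map (restrict< s ℓ) Gs)
          map-restrict< []       = refl
          map-restrict< (G ∷ Gs) = cong₂ _∷_ (restrict<-padₑ ℓ G) (map-restrict< Gs)

    S′ : Sys s
    S′ = Term.sys (_[_/x] s M N)

    Unpadded : ∀ ℓ {F E β} → Env s (F ++ E) → St SN F β → (u w : Fin s → ℕ) → Ty s β → Set
    Unpadded ℓ {F} Γ z u w τ = Σ (Env s F) λ ΓN → (Γ ≡ padₑ ΓN) × J s SN ℓ ΓN z u w τ

    J-copyOfN⇒J-N : ∀ {ℓ F E β} {Γ : Env s (F ++ E)} {u w τ} (z : St SN F β) (x : St S′ (F ++ E) β) →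
                    step S′ x ≡ liftN E (step SN z) → J s S′ ℓ Γ x u w τ → Unpadded ℓ Γ z u w τ
    J-copyOfN⇒J-N {F = F} {E} z x h (j-a e hu hw) =
      ∅ₑ s , padₑ-∅ {E} {F} , j-a (liftN≡cA⇒ (step SN z) (trans (sym h) e)) hu hw
    J-copyOfN⇒J-N {F = F} {E} z x h (j-c e hu hw) =
      ∅ₑ s , padₑ-∅ {E} {F} , j-c (liftN≡cC⇒ (step SN z) (trans (sym h) e)) hu hw
    J-copyOfN⇒J-N {F = F} {E} z x h (j-b₁ e hu hw) =
      ∅ₑ s , padₑ-∅ {E} {F} , j-b₁ (liftN≡cB⇒ (step SN z) (trans (sym h) e)) hu hw
    J-copyOfN⇒J-N {F = F} {E} z x h (j-b₂ e hu hw) =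
      ∅ₑ s , padₑ-∅ {E} {F} , j-b₂ (liftN≡cB⇒ (step SN z) (trans (sym h) e)) hu hw
    J-copyOfN⇒J-N z x h (j-var {A = A} {τ = τ} e c hu hw) with liftN≡var⇒ (step SN z) (trans (sym h) e)
    ... | v₀ , z≡v₀ , refl = singleₑ s v₀ (A , τ) , singleₑ-injectV v₀ _ , j-var z≡v₀ c hu hw
    J-copyOfN⇒J-N z x h (j-lam e D) with liftN≡lam⇒ (step SN z) (trans (sym h) e)
    ... | y₀ , z≡λy₀ , refl with J-copyOfN⇒J-N y₀ _ refl D
    ...   | U ∷ G , Γ≡ , D′ with ∷-injective Γ≡
    ...     | refl , Γ≡G = G , Γ≡G , j-lam z≡λy₀ D′
    J-copyOfN⇒J-N {ℓ} {F} {E} z x h (j-app {m = m} {τ} {u} {w} e Γ₀ u₀ w₀ DK Γs us ws DL hA hu hw)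
      with liftN≡app⇒ (step SN z) (trans (sym h) e)
    ... | K₀ , L₀ , z≡K₀L₀ , refl , refl =
      ⋃ₑ s GsN , Γ≡ ,
      j-app z≡K₀L₀ Γ₀N u₀ w₀ (proj₂ (proj₂ copyK)) ΓsN us ws (λ i → proj₂ (proj₂ (copyL i))) hA′ hu′ hw′
      where
        copyK : Unpadded ℓ Γ₀ K₀ u₀ w₀ (m ⟶ τ)
        copyK = J-copyOfN⇒J-N K₀ _ refl DK

        copyL : ∀ i → Unpadded ℓ (Γs i) L₀ (us i) (ws i) (proj₂ (lookup m i))
        copyL i = J-copyOfN⇒J-N L₀ _ refl (DL i)

        Γ₀N : Env s F
        Γ₀N = proj₁ copyK

        ΓsN : Fin (length m) → Env s F
        ΓsN i = proj₁ (copyL i)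

        GsN : List (Env s F)
        GsN = Γ₀N ∷ tabulate ΓsN

        Gs≡ : Γ₀ ∷ tabulate Γs ≡ map (padₑ {E}) GsN
        Gs≡ = cong₂ _∷_ (proj₁ (proj₂ copyK))
                        (trans (tabulate-cong (λ i → proj₁ (proj₂ (copyL i)))) (sym (map-tabulate ΓsN padₑ)))

        Γ≡ : ⋃ₑ s (Γ₀ ∷ tabulate Γs) ≡ padₑ (⋃ₑ s GsN)
        Γ≡ = trans (cong (⋃ₑ s) Gs≡) (⋃ₑ-padₑ GsN)

        hA′ : ∀ i a → (a ∈ proj₁ (lookup m i)) ⇔ ((0 < us i a + ws i a) ⊎ (restrictA s a (ΓsN i) ≢ ∅ₑ s))
        hA′ i a = ⇔-trans (hA i a) (⇔-refl ⊎-⇔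
          subst (λ G → (restrictA s a G ≢ ∅ₑ s) ⇔ (restrictA s a (ΓsN i) ≢ ∅ₑ s))
                (sym (proj₁ (proj₂ (copyL i)))) (restrictA-padₑ≢∅ a (ΓsN i)))

        hu′ : ∀ a → u a ≡ dupl s (map (restrict≥ s ℓ) GsN) a + (u₀ a + ∑ s (λ i → us i a))
        hu′ a = trans (hu a) (cong (_+ (u₀ a + ∑ s (λ i → us i a)))
          (trans (cong (λ Gs → dupl s (map (restrict≥ s ℓ) Gs) a) Gs≡) (dupl-restrict≥-padₑ ℓ GsN a)))

        hw′ : ∀ a → w a ≡ dupl s (map (restrict< s ℓ) GsN) a + (w₀ a + ∑ s (λ i → ws i a))
        hw′ a = trans (hw a) (cong (_+ (w₀ a + ∑ s (λ i → ws i a)))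
          (trans (cong (λ Gs → dupl s (map (restrict< s ℓ) Gs) a) Gs≡) (dupl-restrict<-padₑ ℓ GsN a)))

  -- Pruning the copies

  module Selection {α : Sort} (R : Set) (wt : R → Fin s → ℕ) (ty : R → Ty s α) where

    key : R → Pair α
    key x = support s (wt x) , ty x

    keys : List R → MSet s α
    keys = map key

    total : List R → Fin s → ℕ
    total l a = sumL s (map (λ x → wt x a) l)

    total-++ : ∀ l l′ a → total (l ++ l′) a ≡ total l a + total l′ a
    total-++ l l′ a = trans (cong (sumL s) (map-++ (λ x → wt x a) l l′)) (sum-++ (map (λ x → wt x a) l) _)

    total-↭ : ∀ {l l′} → l ↭ l′ → ∀ a → total l a ≡ total l′ a
    total-↭ p a = sum-↭ (map⁺ (λ x → wt x a) p)

    countEq-keys-↭ : ∀ {l l′} → l ↭ l′ → ∀ p → countEq s p (keys l) ≡ countEq s p (keys l′)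
    countEq-keys-↭ p q = countEq-↭ q (map⁺ key p)

    𝟙[_∈_] : Fin s → Pair α → ℕ
    𝟙[ a ∈ q ] = if Vec.lookup (proj₁ q) a then 1 else 0

    length-restrictAₘ-∷ : ∀ a q (l : MSet s α) → length (restrictAₘ a (q ∷ l)) ≡ 𝟙[ a ∈ q ] + length (restrictAₘ a l)
    length-restrictAₘ-∷ a q l with Vec.lookup (proj₁ q) a
    ... | true  = refl
    ... | false = refl

    length-restrictAₘ-↭ : ∀ {l l′} → l ↭ l′ → ∀ a → length (restrictAₘ a (keys l)) ≡ length (restrictAₘ a (keys l′))
    length-restrictAₘ-↭ p a = ↭-length (filter-↭ _ (map⁺ key p))

    𝟙[∈key] : ∀ a x → 𝟙[ a ∈ key x ] ≡ (if 0 <ᵇ wt x a then 1 else 0)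
    𝟙[∈key] a x = cong (λ b → if b then 1 else 0) (lookup∘tabulate (λ a → 0 <ᵇ wt x a) a)

    ∉key⇒wt≡0 : ∀ a x → Vec.lookup (proj₁ (key x)) a ≡ false → wt x a ≡ 0
    ∉key⇒wt≡0 a x e with wt x a in e′
    ... | zero  = refl
    ... | suc _ with () ← trans (sym (trans (lookup∘tabulate (λ a → 0 <ᵇ wt x a) a) (cong (0 <ᵇ_) e′))) e

    extractMax : ∀ a c (C : List R) →
      Σ R λ m → Σ (List R) λ C′ → (c ∷ C ↭ m ∷ C′) × All (λ x → wt x a ≤ wt m a) C′
    extractMax a c []       = c , [] , ↭.refl , []
    extractMax a c (c′ ∷ C) with extractMax a c′ C
    ... | m , C′ , p , h with wt c a ≤? wt m a
    ...   | yes c≤m = m , c ∷ C′ , ↭-trans (↭.prep c p) (↭.swap c m ↭.refl) , c≤m ∷ h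
    ...   | no  c≰m = c , m ∷ C′ , ↭.prep c p , m≤c ∷ All.map (λ x≤m → ≤-trans x≤m m≤c) h
      where
        m≤c : wt m a ≤ wt c a
        m≤c = <⇒≤ (≰⇒> c≰m)

    -- Set aside a candidate of maximal weight for each letter; whatever candidate remains is
    -- dominated, letter by letter, by the others.
    dominated : (Ls : List (Fin s)) (C : List R) → length Ls < length C →
      Σ R λ g → Σ (List R) λ C′ → (C ↭ g ∷ C′) × All (λ b → wt g b ≤ total C′ b) Ls
    dominated []       (c ∷ C) _        = c , C , ↭.refl , []
    dominated (a ∷ Ls) (c ∷ C) (s≤s Ls<C) with extractMax a c C
    ... | m , C₁ , p , h with dominated Ls C₁ (subst (length Ls <_) (suc-injective (↭-length p)) Ls<C)
    ...   | g , C₂ , p₂ , dom =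
      g , m ∷ C₂ , ↭-trans p (↭-trans (↭.prep m p₂) (↭.swap m g ↭.refl)) ,
      ≤-trans g≤m (m≤m+n (wt m a) (total C₂ a)) ∷ All.map (λ {b} g≤C₂ → ≤-trans g≤C₂ (m≤n+m _ (wt m b))) dom
      where
        g≤m : wt g a ≤ wt m a
        g≤m with All-resp-↭ p₂ h
        ... | g≤m ∷ _ = g≤m

    partitionByKey : ∀ q (Q : List R) → Σ (List R) λ C → Σ (List R) λ O →
      (Q ↭ C ++ O) × All (λ x → key x ≡ q) C × (length C ≡ countEq s q (keys Q))
    partitionByKey q []      = [] , [] , ↭.refl , [] , refl
    partitionByKey q (x ∷ Q) with partitionByKey q Q | q ≟ₚ key x
    ... | C , O , p , hC , lC | yes refl =
      x ∷ C , O , ↭.prep x p , refl ∷ hC ,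
      trans (cong suc lC) (cong (_+ countEq s (key x) (keys Q)) (sym (δ-refl (key x))))
    ... | C , O , p , hC , lC | no  q≢x  =
      C , x ∷ O , ↭-trans (↭.prep x p) (↭-sym (shift x C O)) , hC ,
      trans lC (sym (cong (_+ countEq s q (keys Q)) (δ-≢ q (key x) q≢x)))

    dominatedWithKey : ∀ q (Q : List R) → suc s ≤ countEq s q (keys Q) →
      Σ R λ g → Σ (List R) λ K → (Q ↭ g ∷ K) × (key g ≡ q) × (∀ a → wt g a ≤ total K a)
    dominatedWithKey q Q s<count with partitionByKey q Q
    ... | C , O , p , hC , lC
      with dominated (allFin s) C (subst₂ _<_ (sym (length-tabulate (λ a → a))) (sym lC) s<count)
    ...   | g , C′ , p′ , dom =
      g , C′ ++ O , ↭-trans p (++⁺ʳ O p′) , g-key , λ a →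
        ≤-trans (All.lookup dom (∈-allFin a)) (subst (total C′ a ≤_) (sym (total-++ C′ O a)) (m≤m+n _ _))
      where
        g-key : key g ≡ q
        g-key with All-resp-↭ p′ hC
        ... | e ∷ _ = e

    record Pruning (L : List R) : Set where
      field
        kept              : List R
        dropped           : Fin s → ℕ
        countEq-kept      : ∀ p → countEq s p (keys kept) ≡ countEq s p (keys L) ⊓ s
        dropped-restrictA : ∀ a → dropped a + length (restrictAₘ a (keys kept)) ≡ length (restrictAₘ a (keys L))
        total≤            : ∀ a → total L a ≤ 2 ^ dropped a * total kept a
        total-kept≤       : ∀ a → total kept a ≤ total L a

    module _ {L : List R} (x : R) (P : Pruning L) where
      open Pruning P

      pruning-keep : countEq s (key x) (keys kept) < s → Pruning (x ∷ L)
      pruning-keep room = record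
        { kept              = x ∷ kept
        ; dropped           = dropped
        ; countEq-kept      = count
        ; dropped-restrictA = λ a → begin-equality
            dropped a + length (restrictAₘ a (key x ∷ keys kept))
              ≡⟨ cong (dropped a +_) (length-restrictAₘ-∷ a (key x) (keys kept)) ⟩
            dropped a + (𝟙[ a ∈ key x ] + length (restrictAₘ a (keys kept)))
              ≡⟨ x∙yz≈y∙xz (dropped a) 𝟙[ a ∈ key x ] _ ⟩
            𝟙[ a ∈ key x ] + (dropped a + length (restrictAₘ a (keys kept)))
              ≡⟨ cong (𝟙[ a ∈ key x ] +_) (dropped-restrictA a) ⟩
            𝟙[ a ∈ key x ] + length (restrictAₘ a (keys L))
              ≡⟨ length-restrictAₘ-∷ a (key x) (keys L) ⟨
            length (restrictAₘ a (key x ∷ keys L)) ∎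
        ; total≤            = λ a → begin
            wt x a + total L a                          ≤⟨ +-mono-≤ (n≤2^m*n (dropped a) (wt x a)) (total≤ a) ⟩
            2 ^ dropped a * wt x a + 2 ^ dropped a * total kept a ≡⟨ *-distribˡ-+ (2 ^ dropped a) (wt x a) _ ⟨
            2 ^ dropped a * (wt x a + total kept a)     ∎
        ; total-kept≤       = λ a → +-monoʳ-≤ (wt x a) (total-kept≤ a)
        }
        where
          open ≤-Reasoning
          count : ∀ p → δ p (key x) + countEq s p (keys kept) ≡ (δ p (key x) + countEq s p (keys L)) ⊓ s
          count p with p ≟ₚ key x
          ... | no  p≢x  rewrite δ-≢ p (key x) p≢x = countEq-kept p
          ... | yes refl rewrite δ-refl p =
            trans (cong suc (trans (countEq-kept p) (m≤n⇒m⊓n≡m (<⇒≤ L<s)))) (sym (m≤n⇒m⊓n≡m L<s))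
            where
              L<s : countEq s p (keys L) < s
              L<s = ≰⇒> λ s≤L → <⇒≢ room (trans (countEq-kept p) (m≥n⇒m⊓n≡n s≤L))

      pruning-drop : ¬ (countEq s (key x) (keys kept) < s) → Pruning (x ∷ L)
      pruning-drop full with dominatedWithKey (key x) (x ∷ kept) s<count
        where
          s<count : suc s ≤ countEq s (key x) (keys (x ∷ kept))
          s<count rewrite δ-refl (key x) = s≤s (≮⇒≥ full)
      ... | g , K , x∷kept↭g∷K , g-key , g≤K = record
        { kept              = K
        ; dropped           = λ a → 𝟙[ a ∈ q ] + dropped a
        ; countEq-kept      = count
        ; dropped-restrictA = λ a → begin-equality
            (𝟙[ a ∈ q ] + dropped a) + length (restrictAₘ a (keys K))
              ≡⟨ cong ((𝟙[ a ∈ q ] + dropped a) +_) (length-K a) ⟩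
            (𝟙[ a ∈ q ] + dropped a) + length (restrictAₘ a (keys kept))
              ≡⟨ +-assoc 𝟙[ a ∈ q ] (dropped a) _ ⟩
            𝟙[ a ∈ q ] + (dropped a + length (restrictAₘ a (keys kept)))
              ≡⟨ cong (𝟙[ a ∈ q ] +_) (dropped-restrictA a) ⟩
            𝟙[ a ∈ q ] + length (restrictAₘ a (keys L))
              ≡⟨ length-restrictAₘ-∷ a q (keys L) ⟨
            length (restrictAₘ a (q ∷ keys L)) ∎
        ; total≤            = total≤′
        ; total-kept≤       = λ a → begin
            total K a            ≤⟨ m≤n+m (total K a) (wt g a) ⟩
            wt g a + total K a   ≡⟨ total-↭ x∷kept↭g∷K a ⟨
            wt x a + total kept a ≤⟨ +-monoʳ-≤ (wt x a) (total-kept≤ a) ⟩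
            wt x a + total L a   ∎
        }
        where
          open ≤-Reasoning
          q : Pair α
          q = key x

          kept≡s : countEq s q (keys kept) ≡ s
          kept≡s = ≤-antisym (subst (_≤ s) (sym (countEq-kept q)) (m⊓n≤n _ s)) (≮⇒≥ full)

          count-K : ∀ p → countEq s p (keys K) ≡ countEq s p (keys kept)
          count-K p = +-cancelˡ-≡ (δ p q) _ _
            (sym (trans (countEq-keys-↭ x∷kept↭g∷K p) (cong (λ k → δ p k + countEq s p (keys K)) g-key)))

          count : ∀ p → countEq s p (keys K) ≡ (δ p q + countEq s p (keys L)) ⊓ s
          count p with p ≟ₚ q
          ... | no  p≢q  rewrite δ-≢ p q p≢q = trans (count-K p) (countEq-kept p)
          ... | yes refl rewrite δ-refl p =
            trans (count-K p) (trans kept≡s (sym (m≥n⇒m⊓n≡n (m≤n⇒m≤1+n s≤L))))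
            where
              s≤L : s ≤ countEq s p (keys L)
              s≤L = ≮⇒≥ λ L<s → <⇒≢ L<s
                      (trans (sym (m≤n⇒m⊓n≡m (<⇒≤ L<s))) (trans (sym (countEq-kept p)) kept≡s))

          length-K : ∀ a → length (restrictAₘ a (keys K)) ≡ length (restrictAₘ a (keys kept))
          length-K a = +-cancelˡ-≡ 𝟙[ a ∈ q ] _ _ (sym (begin-equality
            𝟙[ a ∈ q ] + length (restrictAₘ a (keys kept))   ≡⟨ length-restrictAₘ-∷ a q (keys kept) ⟨
            length (restrictAₘ a (keys (x ∷ kept)))         ≡⟨ length-restrictAₘ-↭ x∷kept↭g∷K a ⟩
            length (restrictAₘ a (keys (g ∷ K)))            ≡⟨ length-restrictAₘ-∷ a (key g) (keys K) ⟩
            𝟙[ a ∈ key g ] + length (restrictAₘ a (keys K))  ≡⟨ cong (λ k → 𝟙[ a ∈ k ] + length (restrictAₘ a (keys K))) g-key ⟩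
            𝟙[ a ∈ q ] + length (restrictAₘ a (keys K))      ∎))

          before-drop : ∀ a → wt x a + total L a ≤ 2 ^ dropped a * (wt g a + total K a)
          before-drop a = begin
            wt x a + total L a                                    ≤⟨ +-mono-≤ (n≤2^m*n (dropped a) (wt x a)) (total≤ a) ⟩
            2 ^ dropped a * wt x a + 2 ^ dropped a * total kept a ≡⟨ *-distribˡ-+ (2 ^ dropped a) (wt x a) _ ⟨
            2 ^ dropped a * (wt x a + total kept a)               ≡⟨ cong (2 ^ dropped a *_) (total-↭ x∷kept↭g∷K a) ⟩
            2 ^ dropped a * (wt g a + total K a)                  ∎

          -- The dropped copy costs a factor 2 exactly at the letters of its set.
          total≤′ : ∀ a → wt x a + total L a ≤ 2 ^ (𝟙[ a ∈ q ] + dropped a) * total K a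
          total≤′ a with Vec.lookup (proj₁ q) a in a∈q
          ... | true  = begin
            wt x a + total L a                      ≤⟨ before-drop a ⟩
            2 ^ dropped a * (wt g a + total K a)    ≤⟨ *-monoʳ-≤ (2 ^ dropped a) (+-monoˡ-≤ (total K a) (g≤K a)) ⟩
            2 ^ dropped a * (total K a + total K a) ≡⟨ cong (2 ^ dropped a *_) (cong (total K a +_) (sym (+-identityʳ _))) ⟩
            2 ^ dropped a * (2 * total K a)         ≡⟨ x*[y*z]≡y*[x*z] (2 ^ dropped a) 2 (total K a) ⟩
            2 * (2 ^ dropped a * total K a)         ≡⟨ *-assoc 2 (2 ^ dropped a) (total K a) ⟨
            2 * 2 ^ dropped a * total K a           ∎
          ... | false = subst (λ n → wt x a + total L a ≤ 2 ^ dropped a * (n + total K a))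
                              (∉key⇒wt≡0 a g (trans (cong (λ k → Vec.lookup (proj₁ k) a) g-key) a∈q))
                              (before-drop a)

    prune : ∀ L → Pruning L
    prune []      = record
      { kept = [] ; dropped = λ _ → 0 ; countEq-kept = λ _ → refl ; dropped-restrictA = λ _ → refl
      ; total≤ = λ _ → z≤n ; total-kept≤ = λ _ → z≤n }
    prune (x ∷ L) with countEq s (key x) (keys (Pruning.kept (prune L))) <? s
    ... | yes room = pruning-keep x (prune L) room
    ... | no  full = pruning-drop x (prune L) full

    extractKey : ∀ q (K : List R) → 1 ≤ countEq s q (keys K) →
      Σ R λ g → Σ (List R) λ K′ → (K ↭ g ∷ K′) × (key g ≡ q)
    extractKey q (x ∷ K) h with q ≟ₚ key x
    ... | yes q≡x = x , K , ↭.refl , sym q≡x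
    ... | no  q≢x with extractKey q K (subst (1 ≤_) (cong (_+ countEq s q (keys K)) (δ-≢ q (key x) q≢x)) h)
    ...   | g , K′ , p , e = g , x ∷ K′ , ↭-trans (↭.prep x p) (↭.swap x g ↭.refl) , e

    reorderByKeys : (X : MSet s α) (K : List R) → (∀ p → countEq s p X ≡ countEq s p (keys K)) →
      Σ (List R) λ K′ → (keys K′ ≡ X) × (K′ ↭ K)
    reorderByKeys []      []      _ = [] , refl , ↭.refl
    reorderByKeys []      (x ∷ K) h = ⊥-elim (1+n≰n (subst (1 ≤_) (sym (h (key x))) (1≤countEq-∷ (key x) (keys K))))
    reorderByKeys (y ∷ X) K       h with extractKey y K (subst (1 ≤_) (h y) (1≤countEq-∷ y X))
    ... | g , K₁ , p , g-key with reorderByKeys X K₁ (λ q → +-cancelˡ-≡ (δ q y) _ _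
          (trans (h q) (trans (countEq-keys-↭ p q) (cong (λ k → δ q k + countEq s q (keys K₁)) g-key))))
    ...   | K′ , keys≡X , p′ = g ∷ K′ , cong₂ _∷_ g-key keys≡X , ↭-trans (↭.prep g p′) (↭-sym p)

    ∑-lookup : ∀ (l : List R) a → ∑ s (λ i → wt (lookup l i) a) ≡ total l a
    ∑-lookup []      a = refl
    ∑-lookup (x ∷ l) a = cong (wt x a +_) (∑-lookup l a)

    total≡0⇒restrictA≡[] : ∀ L a → total L a ≡ 0 → length (restrictAₘ a (keys L)) ≡ 0
    total≡0⇒restrictA≡[] []      a e = refl
    total≡0⇒restrictA≡[] (x ∷ L) a e = begin-equality
      length (restrictAₘ a (keys (x ∷ L)))            ≡⟨ length-restrictAₘ-∷ a (key x) (keys L) ⟩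
      𝟙[ a ∈ key x ] + length (restrictAₘ a (keys L))  ≡⟨ cong₂ _+_ (𝟙[∈key] a x) (total≡0⇒restrictA≡[] L a (m+n≡0⇒n≡0 (wt x a) e)) ⟩
      (if 0 <ᵇ wt x a then 1 else 0) + 0              ≡⟨ cong (λ n → (if 0 <ᵇ n then 1 else 0) + 0) (m+n≡0⇒m≡0 (wt x a) e) ⟩
      0                                               ∎
      where open ≤-Reasoning

    restrictA≡[]⇒total≡0 : ∀ L a → length (restrictAₘ a (keys L)) ≡ 0 → total L a ≡ 0
    restrictA≡[]⇒total≡0 []      a e = refl
    restrictA≡[]⇒total≡0 (x ∷ L) a e with wt x a in wx
    ... | zero  = restrictA≡[]⇒total≡0 L a (m+n≡0⇒n≡0 𝟙[ a ∈ key x ] x∷L≡0)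
      where
        x∷L≡0 : 𝟙[ a ∈ key x ] + length (restrictAₘ a (keys L)) ≡ 0
        x∷L≡0 = trans (sym (length-restrictAₘ-∷ a (key x) (keys L))) e
    ... | suc _ with () ← trans (sym (trans (𝟙[∈key] a x) (cong (λ n → if 0 <ᵇ n then 1 else 0) wx)))
                               (m+n≡0⇒m≡0 𝟙[ a ∈ key x ] (trans (sym (length-restrictAₘ-∷ a (key x) (keys L))) e))

  -- Decomposing a derivation for M[N/x]

  module SubstitutionLemma (s≥1 : 1 ≤ s) (ℓ : ℕ) {Δ σ α} (M : Term s (σ ∷ Δ) α) (N : Term s [] σ)
                           (σ≡ℓ : ord σ ≡ ℓ) (¬occ : ¬ VarOfOrder≥Occurs s ℓ N) where

    open Subst s M N
    open CopiesOfN M N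

    record NTyping : Set where
      constructor nTyping
      field
        weight     : Fin s → ℕ
        type       : Ty s σ
        derivation : J s SN ℓ (∅ₑ s) (Term.root N) (λ _ → 0) weight type
    open NTyping using (weight; type)

    open Selection NTyping weight type

    ℓ≤ᵇσ : (ℓ ≤ᵇ ord σ) ≡ true
    ℓ≤ᵇσ rewrite σ≡ℓ = Equivalence.to T-≡ (≤⇒≤ᵇ (≤-refl {ℓ}))

    σ<ᵇℓ : (ord σ <ᵇ ℓ) ≡ false
    σ<ᵇℓ rewrite σ≡ℓ = n<ᵇn ℓ
      where
        n<ᵇn : ∀ n → (n <ᵇ n) ≡ false
        n<ᵇn zero    = refl
        n<ᵇn (suc n) = n<ᵇn n

    -- A derivation for the state y of M, read inside M[N/x], splits into one for y in which x is
    -- bound to X and those for the copies of N that replaced x. The bindings of x have order ℓ,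
    -- so the copies merged by the unions are counted in u′ (as extra), not in w′.
    record Decomposition (E : Ctx) {β} (y : St SM (E ++ σ ∷ Δ) β) (Γ : Env s (E ++ Δ))
                         (u w : Fin s → ℕ) (τ : Ty s β) : Set where
      field
        X               : MSet s σ
        copies          : List NTyping
        u′ w′ extra     : Fin s → ℕ
        derivation      : J s SM ℓ (insertₑ E X Γ) y u′ w′ τ
        u′≡             : ∀ a → u′ a ≡ u a + extra a
        w≡              : ∀ a → w a ≡ w′ a + total copies a
        extra-restrictA : ∀ a → extra a + length (restrictAₘ a X) ≡ length (restrictAₘ a (keys copies))
        countEq-X       : ∀ p → countEq s p X ≡ countEq s p (keys copies) ⊓ s
        X-normal        : norm s X ≡ X

    decomposition-leaf : ∀ E {β} {y : St SM (E ++ σ ∷ Δ) β} {Γ u w τ} →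
                         J s SM ℓ (insertₑ E [] Γ) y u w τ → Decomposition E y Γ u w τ
    decomposition-leaf E D = record
      { X = [] ; copies = [] ; u′ = _ ; w′ = _ ; extra = λ _ → 0 ; derivation = D
      ; u′≡ = λ _ → sym (+-identityʳ _) ; w≡ = λ _ → sym (+-identityʳ _)
      ; extra-restrictA = λ _ → refl ; countEq-X = λ _ → refl ; X-normal = refl }

    stepM-x : ∀ E (v : Var (E ++ σ ∷ Δ) σ) → splitV E v ≡ inj₁ refl →
              stepM E (var v) ≡ liftN (E ++ Δ) (step SN (Term.root N))
    stepM-x E v e rewrite e = refl

    stepM-other : ∀ E {β} (v : Var (E ++ σ ∷ Δ) β) v′ → splitV E v ≡ inj₂ v′ → stepM E (var v) ≡ var v′
    stepM-other E v v′ e rewrite e = refl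

    singleₑ-x : ∀ E (v : Var (E ++ σ ∷ Δ) σ) p → splitV E v ≡ inj₁ refl →
                singleₑ s v p ≡ insertₑ E (p ∷ []) (∅ₑ s)
    singleₑ-x []      here      p e = refl
    singleₑ-x (γ ∷ E) (there v) p e with splitV E v in e′
    ... | inj₁ refl = cong ([] ∷_) (singleₑ-x E v p e′)

    singleₑ-other : ∀ E {β} (v : Var (E ++ σ ∷ Δ) β) v′ p → splitV E v ≡ inj₂ v′ →
                    singleₑ s v p ≡ insertₑ E [] (singleₑ s v′ p)
    singleₑ-other []      (there v) v′ p refl = refl
    singleₑ-other (γ ∷ E) here      v′ p refl = cong ((p ∷ []) ∷_) (insertₑ-∅ E)
    singleₑ-other (γ ∷ E) (there v) v′ p e with splitV E v in e′
    singleₑ-other (γ ∷ E) (there v) v′ p () | inj₁ refl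
    ... | inj₂ v₀ with refl ← e = cong ([] ∷_) (singleₑ-other E v v₀ p e′)

    module _ {E β} {y : St SM (E ++ σ ∷ Δ) β} {Γ u w τ} (R : Decomposition E y Γ u w τ) where
      open Decomposition R

      restrictA-X≤ : ∀ a → length (restrictAₘ a X) ≤ length (restrictAₘ a (keys copies))
      restrictA-X≤ a = subst (length (restrictAₘ a X) ≤_) (extra-restrictA a) (m≤n+m _ (extra a))

      restrictA-copies>0⇒X>0 : ∀ a → 0 < length (restrictAₘ a (keys copies)) → 0 < length (restrictAₘ a X)
      restrictA-copies>0⇒X>0 a _ with restrictAₘ a (keys copies) in e
      ... | p ∷ rest = X-nonempty (Vec.lookup (proj₁ p) a) refl
        where
          a∈_ : Pair σ → Bool
          a∈ q = Vec.lookup (proj₁ q) a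

          p∈copies↾a : 1 ≤ countEq s p (restrictAₘ a (keys copies))
          p∈copies↾a = subst (λ l → 1 ≤ countEq s p l) (sym e) (1≤countEq-∷ p rest)

          X-nonempty : ∀ b → a∈ p ≡ b → 0 < length (restrictAₘ a X)
          X-nonempty false a∉p = ⊥-elim (1+n≰n (subst (1 ≤_) (countEq-filterᵇ-false a∈_ p (keys copies) a∉p) p∈copies↾a))
          X-nonempty true  a∈p with restrictAₘ a X in eX
          ... | _ ∷ _ = s≤s z≤n
          ... | []    = ⊥-elim (1+n≰n (begin
            1                                     ≤⟨ ⊓-glb p∈copies s≥1 ⟩
            countEq s p (keys copies) ⊓ s         ≡⟨ countEq-X p ⟨
            countEq s p X                         ≡⟨ countEq-filterᵇ-true a∈_ p X a∈p ⟨
            countEq s p (restrictAₘ a X)          ≡⟨ cong (countEq s p) eX ⟩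
            0                                     ∎))
            where
              open ≤-Reasoning
              p∈copies : 1 ≤ countEq s p (keys copies)
              p∈copies = subst (1 ≤_) (countEq-filterᵇ-true a∈_ p (keys copies) a∈p) p∈copies↾a

      restrictA-copies>0⇒uw>0 : ∀ a → 0 < length (restrictAₘ a (keys copies)) → 0 < u a + w a
      restrictA-copies>0⇒uw>0 a pos = begin-strict
        0                     <⟨ n≢0⇒n>0 (λ T≡0 → <-irrefl (sym (total≡0⇒restrictA≡[] copies a T≡0)) pos) ⟩
        total copies a        ≤⟨ m≤n+m _ (w′ a) ⟩
        w′ a + total copies a ≡⟨ w≡ a ⟨
        w a                   ≤⟨ m≤n+m (w a) (u a) ⟩
        u a + w a             ∎
        where open ≤-Reasoning

      -- The side condition of rule (@) on the argument types survives the decomposition.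
      positivity-insertₑ : ∀ a → ((0 < u a + w a) ⊎ (restrictA s a Γ ≢ ∅ₑ s)) ⇔
                                 ((0 < u′ a + w′ a) ⊎ (restrictA s a (insertₑ E X Γ) ≢ ∅ₑ s))
      positivity-insertₑ a = mk⇔ to from
        where
          restrictA-X,Γ≡∅ : restrictA s a (insertₑ E X Γ) ≡ ∅ₑ s → (restrictAₘ a X ≡ []) × (restrictA s a Γ ≡ ∅ₑ s)
          restrictA-X,Γ≡∅ e = insertₑ≡∅⇒ E (restrictAₘ a X) (restrictA s a Γ) (trans (sym (restrictA-insertₑ E a X Γ)) e)

          ≮⇒≡0 : ∀ {n} → ¬ (0 < n) → n ≡ 0
          ≮⇒≡0 {n} 0≮n = n≤0⇒n≡0 (≮⇒≥ 0≮n)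

          length≡0⇒≡[] : ∀ {A : Set} (l : List A) → length l ≡ 0 → l ≡ []
          length≡0⇒≡[] [] _ = refl

          to : _ → _
          to (inj₂ Γ≢∅) = inj₂ (Γ≢∅ ∘ proj₂ ∘ restrictA-X,Γ≡∅)
          to (inj₁ pos) with 0 <? length (restrictAₘ a X)
          ... | yes X>0 = inj₂ (λ e → <-irrefl (sym (cong length (proj₁ (restrictA-X,Γ≡∅ e)))) X>0)
          ... | no  X≯0 = inj₁ (≤-trans pos (+-mono-≤ (subst (u a ≤_) (sym (u′≡ a)) (m≤m+n (u a) (extra a)))
                                                      (≤-reflexive (trans (w≡ a) (trans (cong (w′ a +_) total≡0) (+-identityʳ _))))))
            where
              total≡0 : total copies a ≡ 0
              total≡0 = restrictA≡[]⇒total≡0 copies a (≮⇒≡0 (X≯0 ∘ restrictA-copies>0⇒X>0 a))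

          from : _ → _
          from (inj₁ pos) with 0 <? length (restrictAₘ a (keys copies))
          ... | yes L>0 = inj₁ (restrictA-copies>0⇒uw>0 a L>0)
          ... | no  L≯0 = inj₁ (≤-trans pos (+-mono-≤ (≤-reflexive (trans (u′≡ a) (trans (cong (u a +_) extra≡0) (+-identityʳ _))))
                                                      (subst (w′ a ≤_) (sym (w≡ a)) (m≤m+n (w′ a) (total copies a)))))
            where
              extra≡0 : extra a ≡ 0
              extra≡0 = m+n≡0⇒m≡0 (extra a) (trans (extra-restrictA a) (≮⇒≡0 L≯0))
          from (inj₂ XΓ≢∅) with 0 <? length (restrictAₘ a X)
          ... | yes X>0 = inj₁ (restrictA-copies>0⇒uw>0 a (≤-trans X>0 (restrictA-X≤ a)))
          ... | no  X≯0 = inj₂ λ Γ≡∅ → XΓ≢∅ (begin-equality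
            restrictA s a (insertₑ E X Γ)                     ≡⟨ restrictA-insertₑ E a X Γ ⟩
            insertₑ E (restrictAₘ a X) (restrictA s a Γ)      ≡⟨ cong₂ (insertₑ E) (length≡0⇒≡[] (restrictAₘ a X) (≮⇒≡0 X≯0)) Γ≡∅ ⟩
            insertₑ E [] (∅ₑ s)                               ≡⟨ insertₑ-∅ E ⟨
            ∅ₑ s                                              ∎)
            where open ≡-Reasoning renaming (begin_ to begin-equality_)

    module _ (E : Ctx) {k} (X₀ : MSet s σ) (Xs : Fin k → MSet s σ) (Γ₀ : Env s (E ++ Δ)) (Γs : Fin k → Env s (E ++ Δ)) where

      private
        map-∷-tabulate : ∀ {A B : Set} (f : A → B) x (xs : Fin k → A) → map f (x ∷ tabulate xs) ≡ f x ∷ tabulate (f ∘ xs)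
        map-∷-tabulate f x xs = cong (f x ∷_) (map-tabulate xs f)

        no-x-bindings : List (MSet s σ)
        no-x-bindings = [] ∷ tabulate {n = k} (λ _ → [])

        duplₘ-[] : ∀ a → duplₘ no-x-bindings a ≡ 0
        duplₘ-[] a = trans (cong (_∸ U) sum≡0) (0∸n≡0 U)
          where
            sum≡0 : sumL s (map (λ X → length (restrictAₘ a X)) no-x-bindings) ≡ 0
            sum≡0 = trans (sumL-map-tabulate {k = k} (λ X → length (restrictAₘ {σ} a X)) (λ _ → []))
                          (∑-zero {k} (λ _ → 0) (λ _ → refl))

            U : ℕ
            U = length (⋃ₘ (map (restrictAₘ a) no-x-bindings))

      dupl≥-insertₑ : ∀ a →
        dupl s (map (restrict≥ s ℓ) (insertₑ E X₀ Γ₀ ∷ tabulate (λ i → insertₑ E (Xs i) (Γs i)))) a ≡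
        duplₘ (X₀ ∷ tabulate Xs) a + dupl s (map (restrict≥ s ℓ) (Γ₀ ∷ tabulate Γs)) a
      dupl≥-insertₑ a = begin-equality
        dupl s (map (restrict≥ s ℓ) (insertₑ E X₀ Γ₀ ∷ tabulate (λ i → insertₑ E (Xs i) (Γs i)))) a
          ≡⟨ cong (λ Gs → dupl s Gs a)
                  (trans (map-∷-tabulate (restrict≥ s ℓ) _ _)
                         (cong₂ _∷_ (restrict≥-insertₑ E ℓ ℓ≤ᵇσ X₀ Γ₀) (tabulate-cong λ i → restrict≥-insertₑ E ℓ ℓ≤ᵇσ (Xs i) (Γs i)))) ⟩
        dupl s (insertₑ E X₀ (restrict≥ s ℓ Γ₀) ∷ tabulate (λ i → insertₑ E (Xs i) (restrict≥ s ℓ (Γs i)))) a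
          ≡⟨ dupl-insertₑ-family E X₀ Xs (restrict≥ s ℓ Γ₀) (restrict≥ s ℓ ∘ Γs) a ⟩
        duplₘ (X₀ ∷ tabulate Xs) a + dupl s (restrict≥ s ℓ Γ₀ ∷ tabulate (restrict≥ s ℓ ∘ Γs)) a
          ≡⟨ cong (λ Gs → duplₘ (X₀ ∷ tabulate Xs) a + dupl s Gs a) (map-∷-tabulate (restrict≥ s ℓ) Γ₀ Γs) ⟨
        duplₘ (X₀ ∷ tabulate Xs) a + dupl s (map (restrict≥ s ℓ) (Γ₀ ∷ tabulate Γs)) a ∎
        where open ≤-Reasoning

      dupl<-insertₑ : ∀ a →
        dupl s (map (restrict< s ℓ) (insertₑ E X₀ Γ₀ ∷ tabulate (λ i → insertₑ E (Xs i) (Γs i)))) a ≡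
        dupl s (map (restrict< s ℓ) (Γ₀ ∷ tabulate Γs)) a
      dupl<-insertₑ a = begin-equality
        dupl s (map (restrict< s ℓ) (insertₑ E X₀ Γ₀ ∷ tabulate (λ i → insertₑ E (Xs i) (Γs i)))) a
          ≡⟨ cong (λ Gs → dupl s Gs a)
                  (trans (map-∷-tabulate (restrict< s ℓ) _ _)
                         (cong₂ _∷_ (restrict<-insertₑ E ℓ σ<ᵇℓ X₀ Γ₀) (tabulate-cong λ i → restrict<-insertₑ E ℓ σ<ᵇℓ (Xs i) (Γs i)))) ⟩
        dupl s (insertₑ E [] (restrict< s ℓ Γ₀) ∷ tabulate (λ i → insertₑ E [] (restrict< s ℓ (Γs i)))) a
          ≡⟨ dupl-insertₑ-family E [] (λ _ → []) (restrict< s ℓ Γ₀) (restrict< s ℓ ∘ Γs) a ⟩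
        duplₘ no-x-bindings a + dupl s (restrict< s ℓ Γ₀ ∷ tabulate (restrict< s ℓ ∘ Γs)) a
          ≡⟨ cong₂ _+_ (duplₘ-[] a) (cong (λ Gs → dupl s Gs a) (sym (map-∷-tabulate (restrict< s ℓ) Γ₀ Γs))) ⟩
        dupl s (map (restrict< s ℓ) (Γ₀ ∷ tabulate Γs)) a ∎
        where open ≤-Reasoning

    keys-additive : ∀ (f : MSet s σ → ℕ) → (∀ X Y → f (X ++ Y) ≡ f X + f Y) →
                    ∀ (L₀ : List NTyping) {k} (Ls : Fin k → List NTyping) →
                    f (keys (L₀ ++ concat (tabulate Ls))) ≡ f (keys L₀) + ∑ s (λ i → f (keys (Ls i)))
    keys-additive f f++ L₀ Ls = begin-equality
      f (keys (L₀ ++ concat (tabulate Ls)))        ≡⟨ cong f (map-++ key L₀ _) ⟩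
      f (keys L₀ ++ keys (concat (tabulate Ls)))   ≡⟨ f++ (keys L₀) _ ⟩
      f (keys L₀) + f (keys (concat (tabulate Ls))) ≡⟨ cong (f (keys L₀) +_) (∑-concat (f ∘ keys) f[] f∘keys-++ Ls) ⟩
      f (keys L₀) + ∑ s (λ i → f (keys (Ls i)))    ∎
      where
        open ≤-Reasoning
        f[] : f [] ≡ 0
        f[] = +-cancelˡ-≡ (f []) _ _ (trans (sym (f++ [] [])) (sym (+-identityʳ (f []))))

        f∘keys-++ : ∀ l l′ → f (keys (l ++ l′)) ≡ f (keys l) + f (keys l′)
        f∘keys-++ l l′ = trans (cong f (map-++ key l l′)) (f++ (keys l) (keys l′))

    decomposition-app :
      ∀ E {γ β} {y : St SM (E ++ σ ∷ Δ) β} {K L} {m : MSet s γ} {τ : Ty s β} {u w} →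
      step SM y ≡ app K L →
      (Γ₀ : Env s (E ++ Δ)) (u₀ w₀ : Fin s → ℕ) → Decomposition E K Γ₀ u₀ w₀ (m ⟶ τ) →
      (Γs : Fin (length m) → Env s (E ++ Δ)) (us ws : Fin (length m) → Fin s → ℕ) →
      (∀ i → Decomposition E L (Γs i) (us i) (ws i) (proj₂ (lookup m i))) →
      (∀ i a → (a ∈ proj₁ (lookup m i)) ⇔ ((0 < us i a + ws i a) ⊎ (restrictA s a (Γs i) ≢ ∅ₑ s))) →
      (∀ a → u a ≡ dupl s (map (restrict≥ s ℓ) (Γ₀ ∷ tabulate Γs)) a + (u₀ a + ∑ s (λ i → us i a))) →
      (∀ a → w a ≡ dupl s (map (restrict< s ℓ) (Γ₀ ∷ tabulate Γs)) a + (w₀ a + ∑ s (λ i → ws i a))) →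
      Decomposition E y (⋃ₑ s (Γ₀ ∷ tabulate Γs)) u w τ
    decomposition-app E {y = y} {m = m} {τ} {u} {w} y≡KL Γ₀ u₀ w₀ R₀ Γs us ws Rs hA hu hw = record
      { X               = ⋃ₘ Xs
      ; copies          = copies₀ ++ concat (tabulate copiesᵢ)
      ; u′              = u′
      ; w′              = w′
      ; extra           = extra
      ; derivation      = subst (λ G → J s SM ℓ G y u′ w′ τ) (⋃ₑ-insertₑ-family E X₀ Xᵢ Γ₀ Γs)
          (j-app y≡KL Γ₀′ u′₀ w′₀ D₀ Γ′ u′ᵢ w′ᵢ (Decomposition.derivation ∘ Rs)
                 (λ i a → ⇔-trans (hA i a) (positivity-insertₑ (Rs i) a)) (λ _ → refl) (λ _ → refl))
      ; u′≡             = u′≡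
      ; w≡              = w≡
      ; extra-restrictA = extra-restrictA
      ; countEq-X       = countEq-X
      ; X-normal        = norm-idem (X₀ ++ ⋃ₘ (tabulate Xᵢ))
      }
      where
        open Decomposition R₀ using ()
          renaming (X to X₀; copies to copies₀; u′ to u′₀; w′ to w′₀; extra to extra₀; derivation to D₀)
        module Rᵢ i = Decomposition (Rs i)

        Xᵢ : Fin (length m) → MSet s σ
        Xᵢ i = Rᵢ.X i

        copiesᵢ : Fin (length m) → List NTyping
        copiesᵢ i = Rᵢ.copies i

        u′ᵢ w′ᵢ extraᵢ : Fin (length m) → Fin s → ℕ
        u′ᵢ i = Rᵢ.u′ i
        w′ᵢ i = Rᵢ.w′ i
        extraᵢ i = Rᵢ.extra i

        Xs : List (MSet s σ)
        Xs = X₀ ∷ tabulate Xᵢ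

        Γ₀′ : Env s (E ++ σ ∷ Δ)
        Γ₀′ = insertₑ E X₀ Γ₀

        Γ′ : Fin (length m) → Env s (E ++ σ ∷ Δ)
        Γ′ i = insertₑ E (Xᵢ i) (Γs i)

        d≥ d< : Fin s → ℕ
        d≥ a = dupl s (map (restrict≥ s ℓ) (Γ₀ ∷ tabulate Γs)) a
        d< a = dupl s (map (restrict< s ℓ) (Γ₀ ∷ tabulate Γs)) a

        u′ w′ extra : Fin s → ℕ
        u′ a = dupl s (map (restrict≥ s ℓ) (Γ₀′ ∷ tabulate Γ′)) a + (u′₀ a + ∑ s (λ i → u′ᵢ i a))
        w′ a = dupl s (map (restrict< s ℓ) (Γ₀′ ∷ tabulate Γ′)) a + (w′₀ a + ∑ s (λ i → w′ᵢ i a))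
        extra a = duplₘ Xs a + (extra₀ a + ∑ s (λ i → extraᵢ i a))

        open ≡-Reasoning

        u′≡ : ∀ a → u′ a ≡ u a + extra a
        u′≡ a = begin
          u′ a
            ≡⟨ cong₂ _+_ (dupl≥-insertₑ E X₀ Xᵢ Γ₀ Γs a)
                         (cong₂ _+_ (Decomposition.u′≡ R₀ a) (trans (∑-cong (λ i → Rᵢ.u′≡ i a)) (∑-+ (λ i → us i a) (λ i → extraᵢ i a)))) ⟩
          (duplₘ Xs a + d≥ a) + ((u₀ a + extra₀ a) + (∑ s (λ i → us i a) + ∑ s (λ i → extraᵢ i a)))
            ≡⟨ cong₂ _+_ (+-comm (duplₘ Xs a) (d≥ a)) (interchange (u₀ a) (extra₀ a) _ _) ⟩
          (d≥ a + duplₘ Xs a) + ((u₀ a + ∑ s (λ i → us i a)) + (extra₀ a + ∑ s (λ i → extraᵢ i a)))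
            ≡⟨ interchange (d≥ a) (duplₘ Xs a) _ _ ⟩
          (d≥ a + (u₀ a + ∑ s (λ i → us i a))) + extra a
            ≡⟨ cong (_+ extra a) (hu a) ⟨
          u a + extra a ∎

        w≡ : ∀ a → w a ≡ w′ a + total (copies₀ ++ concat (tabulate copiesᵢ)) a
        w≡ a = begin
          w a
            ≡⟨ hw a ⟩
          d< a + (w₀ a + ∑ s (λ i → ws i a))
            ≡⟨ cong (d< a +_) (cong₂ _+_ (Decomposition.w≡ R₀ a)
                                         (trans (∑-cong (λ i → Rᵢ.w≡ i a)) (∑-+ (λ i → w′ᵢ i a) (λ i → total (copiesᵢ i) a)))) ⟩
          d< a + ((w′₀ a + total copies₀ a) + (∑ s (λ i → w′ᵢ i a) + ∑ s (λ i → total (copiesᵢ i) a)))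
            ≡⟨ cong (d< a +_) (interchange (w′₀ a) _ _ _) ⟩
          d< a + ((w′₀ a + ∑ s (λ i → w′ᵢ i a)) + (total copies₀ a + ∑ s (λ i → total (copiesᵢ i) a)))
            ≡⟨ +-assoc (d< a) _ _ ⟨
          (d< a + (w′₀ a + ∑ s (λ i → w′ᵢ i a))) + (total copies₀ a + ∑ s (λ i → total (copiesᵢ i) a))
            ≡⟨ cong₂ _+_ (cong (_+ (w′₀ a + ∑ s (λ i → w′ᵢ i a))) (dupl<-insertₑ E X₀ Xᵢ Γ₀ Γs a)) total-copies ⟨
          w′ a + total (copies₀ ++ concat (tabulate copiesᵢ)) a ∎
          where
            total-copies : total (copies₀ ++ concat (tabulate copiesᵢ)) a ≡
                           total copies₀ a + ∑ s (λ i → total (copiesᵢ i) a)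
            total-copies = trans (total-++ copies₀ _ a)
                                 (cong (total copies₀ a +_) (∑-concat (λ l → total l a) refl (λ l l′ → total-++ l l′ a) copiesᵢ))

        extra-restrictA : ∀ a → extra a + length (restrictAₘ a (⋃ₘ Xs)) ≡
                                length (restrictAₘ a (keys (copies₀ ++ concat (tabulate copiesᵢ))))
        extra-restrictA a = begin
          (S ∸ U + ε) + length (restrictAₘ a (⋃ₘ Xs))
            ≡⟨ cong ((S ∸ U + ε) +_) (length-⋃ₘ-restrictAₘ a Xs) ⟨
          (S ∸ U + ε) + U
            ≡⟨ trans (cong (_+ U) (+-comm (S ∸ U) ε)) (trans (+-assoc ε (S ∸ U) U) (cong (ε +_) (m∸n+n≡m U≤S))) ⟩
          ε + S
            ≡⟨ cong (ε +_) (cong (length (restrictAₘ a X₀) +_) (sumL-map-tabulate (λ X → length (restrictAₘ a X)) Xᵢ)) ⟩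
          (extra₀ a + ∑ s (λ i → extraᵢ i a)) + (length (restrictAₘ a X₀) + ∑ s (λ i → length (restrictAₘ a (Xᵢ i))))
            ≡⟨ interchange (extra₀ a) _ _ _ ⟩
          (extra₀ a + length (restrictAₘ a X₀)) + (∑ s (λ i → extraᵢ i a) + ∑ s (λ i → length (restrictAₘ a (Xᵢ i))))
            ≡⟨ cong₂ _+_ (Decomposition.extra-restrictA R₀ a)
                         (trans (sym (∑-+ (λ i → extraᵢ i a) (λ i → length (restrictAₘ a (Xᵢ i))))) (∑-cong (λ i → Rᵢ.extra-restrictA i a))) ⟩
          length (restrictAₘ a (keys copies₀)) + ∑ s (λ i → length (restrictAₘ a (keys (copiesᵢ i))))
            ≡⟨ keys-additive (λ X → length (restrictAₘ a X)) (length-restrictAₘ-++ a) copies₀ copiesᵢ ⟨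
          length (restrictAₘ a (keys (copies₀ ++ concat (tabulate copiesᵢ)))) ∎
          where
            S U ε : ℕ
            S = sumL s (map (λ X → length (restrictAₘ a X)) Xs)
            U = length (⋃ₘ (map (restrictAₘ a) Xs))
            ε = extra₀ a + ∑ s (λ i → extraᵢ i a)
            U≤S : U ≤ S
            U≤S = length-⋃ₘ-map≤ (restrictAₘ a) Xs

        countEq-X : ∀ p → countEq s p (⋃ₘ Xs) ≡ countEq s p (keys (copies₀ ++ concat (tabulate copiesᵢ))) ⊓ s
        countEq-X p = begin
          countEq s p (⋃ₘ Xs)
            ≡⟨ countEq-⋃ₘ p Xs ⟩
          (countEq s p X₀ + sumL s (map (countEq s p) (tabulate Xᵢ))) ⊓ s
            ≡⟨ cong (λ n → (countEq s p X₀ + n) ⊓ s) (sumL-map-tabulate (countEq s p) Xᵢ) ⟩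
          (countEq s p X₀ + ∑ s (λ i → countEq s p (Xᵢ i))) ⊓ s
            ≡⟨ cong₂ (λ x y → (x + y) ⊓ s) (Decomposition.countEq-X R₀ p) (∑-cong (λ i → Rᵢ.countEq-X i p)) ⟩
          (c₀ ⊓ s + ∑ s (λ i → cᵢ i ⊓ s)) ⊓ s
            ≡⟨ m⊓k+n⊓k≡m+n⊓k c₀ _ ⟩
          (c₀ + ∑ s (λ i → cᵢ i ⊓ s)) ⊓ s
            ≡⟨ m+n⊓k⊓k≡m+n⊓k c₀ _ s ⟨
          (c₀ + ∑ s (λ i → cᵢ i ⊓ s) ⊓ s) ⊓ s
            ≡⟨ cong (λ n → (c₀ + n) ⊓ s) (∑-⊓ cᵢ) ⟩
          (c₀ + ∑ s cᵢ ⊓ s) ⊓ s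
            ≡⟨ m+n⊓k⊓k≡m+n⊓k c₀ _ s ⟩
          (c₀ + ∑ s cᵢ) ⊓ s
            ≡⟨ cong (_⊓ s) (keys-additive (countEq s p) (countEq-++ p) copies₀ copiesᵢ) ⟨
          countEq s p (keys (copies₀ ++ concat (tabulate copiesᵢ))) ⊓ s ∎
          where
            c₀ : ℕ
            c₀ = countEq s p (keys copies₀)
            cᵢ : Fin (length m) → ℕ
            cᵢ i = countEq s p (keys (copiesᵢ i))
            m⊓k+n⊓k≡m+n⊓k : ∀ m n → (m ⊓ s + n) ⊓ s ≡ (m + n) ⊓ s
            m⊓k+n⊓k≡m+n⊓k m n = trans (cong (_⊓ s) (+-comm (m ⊓ s) n))
                                  (trans (m+n⊓k⊓k≡m+n⊓k n m s) (cong (_⊓ s) (+-comm n m)))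

    decomposition-lam : ∀ E {γ β} {y : St SM (E ++ σ ∷ Δ) (γ ⇒ β)} {z} {Γ : Env s (E ++ Δ)} {m u w τ} →
                        step SM y ≡ lam z → Decomposition (γ ∷ E) z (m ∷ Γ) u w τ → Decomposition E y Γ u w (m ⟶ τ)
    decomposition-lam E y≡λz R = record
      { X = X ; copies = copies ; u′ = u′ ; w′ = w′ ; extra = extra ; derivation = j-lam y≡λz derivation
      ; u′≡ = u′≡ ; w≡ = w≡ ; extra-restrictA = extra-restrictA ; countEq-X = countEq-X ; X-normal = X-normal }
      where open Decomposition R

    decomposition-copyOfN : ∀ E (y : St SM (E ++ σ ∷ Δ) σ) (v : Var (E ++ σ ∷ Δ) σ) {Γ u w τ} →
      step SM y ≡ var v → splitV E v ≡ inj₁ refl → J s S′ ℓ Γ (inM E refl y) u w τ → Decomposition E y Γ u w τ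
    decomposition-copyOfN E y v {u = u} {w} {τ} y≡v v≡x D
      with J-copyOfN⇒J-N {F = []} {E = E ++ Δ} (Term.root N) (inM E refl y) (trans (cong (stepM E) y≡v) (stepM-x E v v≡x)) D
    ... | [] , refl , DN = record
      { X               = key copy ∷ []
      ; copies          = copy ∷ []
      ; u′              = λ _ → 0
      ; w′              = λ _ → 0
      ; extra           = λ _ → 0
      ; derivation      = subst (λ G → J s SM ℓ G y (λ _ → 0) (λ _ → 0) τ) (singleₑ-x E v (key copy) v≡x)
                                (j-var y≡v (proj₂ (J⇒canon s≥1 DN)) (λ _ → refl) (λ _ → refl))
      ; u′≡             = λ a → sym (trans (+-identityʳ (u a)) (u≡0 a))
      ; w≡              = λ a → sym (+-identityʳ (w a))
      ; extra-restrictA = λ _ → refl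
      ; countEq-X       = λ p →
          sym (m≤n⇒m⊓n≡m (≤-trans (≤-reflexive (+-identityʳ _)) (≤-trans (δ≤1 p (key copy)) s≥1)))
      ; X-normal        = norm-singleton s≥1 (key copy)
      }
      where
        u≡0 : ∀ a → u a ≡ 0
        u≡0 = proj₂ (¬Occ⇒lowOrder (Term.root N) ¬occ DN)
        copy : NTyping
        copy = nTyping w τ (J-resp-≗ DN u≡0 (λ _ → refl))

    private
      stepM≡ : ∀ E {β} {y : St SM (E ++ σ ∷ Δ) β} {nd nd′} →
               step SM y ≡ nd → step S′ (inM E refl y) ≡ nd′ → stepM E nd ≡ nd′
      stepM≡ E y≡ e = trans (sym (cong (stepM E) y≡)) e

      leaf : ∀ E {β} {y : St SM (E ++ σ ∷ Δ) β} {u w τ} → J s SM ℓ (∅ₑ s) y u w τ → Decomposition E y (∅ₑ s) u w τ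
      leaf E {y = y} {u} {w} {τ} D = decomposition-leaf E (subst (λ G → J s SM ℓ G y u w τ) (insertₑ-∅ E) D)

    decompose-var : ∀ E {β} {y : St SM (E ++ σ ∷ Δ) β} {v v′} {Γ u w τ} → step SM y ≡ var v → splitV E v ≡ inj₂ v′ →
                    J s S′ ℓ Γ (inM E refl y) u w τ → Decomposition E y Γ u w τ
    decompose-var E {y = y} {v} {v′} {u = u} {w} {τ} y≡ v≡ (j-var e c hu hw)
      with refl ← trans (sym (stepM-other E v v′ v≡)) (stepM≡ E y≡ e) =
      decomposition-leaf E (subst (λ G → J s SM ℓ G y u w τ) (singleₑ-other E v v′ _ v≡) (j-var y≡ c hu hw))
    decompose-var E {v = v} {v′} y≡ v≡ (j-a e _ _)     with () ← trans (sym (stepM-other E v v′ v≡)) (stepM≡ E y≡ e)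
    decompose-var E {v = v} {v′} y≡ v≡ (j-c e _ _)     with () ← trans (sym (stepM-other E v v′ v≡)) (stepM≡ E y≡ e)
    decompose-var E {v = v} {v′} y≡ v≡ (j-b₁ e _ _)    with () ← trans (sym (stepM-other E v v′ v≡)) (stepM≡ E y≡ e)
    decompose-var E {v = v} {v′} y≡ v≡ (j-b₂ e _ _)    with () ← trans (sym (stepM-other E v v′ v≡)) (stepM≡ E y≡ e)
    decompose-var E {v = v} {v′} y≡ v≡ (j-lam e _)     with () ← trans (sym (stepM-other E v v′ v≡)) (stepM≡ E y≡ e)
    decompose-var E {v = v} {v′} y≡ v≡ (j-app e _ _ _ _ _ _ _ _ _ _ _) with () ← trans (sym (stepM-other E v v′ v≡)) (stepM≡ E y≡ e)

    decompose-cA : ∀ E {y : St SM (E ++ σ ∷ Δ) (o ⇒ o)} {i Γ u w τ} → step SM y ≡ cA i →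
                   J s S′ ℓ Γ (inM E refl y) u w τ → Decomposition E y Γ u w τ
    decompose-cA E y≡ (j-a e hu hw) with refl ← stepM≡ E y≡ e = leaf E (j-a y≡ hu hw)
    decompose-cA E y≡ (j-var e _ _ _)                 with () ← stepM≡ E y≡ e
    decompose-cA E y≡ (j-lam e _)                     with () ← stepM≡ E y≡ e
    decompose-cA E y≡ (j-app e _ _ _ _ _ _ _ _ _ _ _) with () ← stepM≡ E y≡ e

    decompose-cB : ∀ E {y : St SM (E ++ σ ∷ Δ) (o ⇒ o ⇒ o)} {Γ u w τ} → step SM y ≡ cB →
                   J s S′ ℓ Γ (inM E refl y) u w τ → Decomposition E y Γ u w τ
    decompose-cB E y≡ (j-b₁ e hu hw)                  = leaf E (j-b₁ y≡ hu hw)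
    decompose-cB E y≡ (j-b₂ e hu hw)                  = leaf E (j-b₂ y≡ hu hw)
    decompose-cB E y≡ (j-var e _ _ _)                 with () ← stepM≡ E y≡ e
    decompose-cB E y≡ (j-lam e _)                     with () ← stepM≡ E y≡ e
    decompose-cB E y≡ (j-app e _ _ _ _ _ _ _ _ _ _ _) with () ← stepM≡ E y≡ e

    decompose-cC : ∀ E {y : St SM (E ++ σ ∷ Δ) o} {Γ u w τ} → step SM y ≡ cC →
                   J s S′ ℓ Γ (inM E refl y) u w τ → Decomposition E y Γ u w τ
    decompose-cC E y≡ (j-c e hu hw)                   = leaf E (j-c y≡ hu hw)
    decompose-cC E y≡ (j-var e _ _ _)                 with () ← stepM≡ E y≡ e
    decompose-cC E y≡ (j-app e _ _ _ _ _ _ _ _ _ _ _) with () ← stepM≡ E y≡ e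

    decompose-cΩ : ∀ E {y : St SM (E ++ σ ∷ Δ) o} {Γ u w τ} → step SM y ≡ cΩ →
                   J s S′ ℓ Γ (inM E refl y) u w τ → Decomposition E y Γ u w τ
    decompose-cΩ E y≡ (j-c e _ _)                     with () ← stepM≡ E y≡ e
    decompose-cΩ E y≡ (j-var e _ _ _)                 with () ← stepM≡ E y≡ e
    decompose-cΩ E y≡ (j-app e _ _ _ _ _ _ _ _ _ _ _) with () ← stepM≡ E y≡ e

    mutual
      decompose : ∀ E {β} (y : St SM (E ++ σ ∷ Δ) β) {Γ u w τ} →
                  J s S′ ℓ Γ (inM E refl y) u w τ → Decomposition E y Γ u w τ
      decompose E y D with step SM y in y≡
      ... | var v with splitV E v in v≡
      ...   | inj₁ refl = decomposition-copyOfN E y v y≡ v≡ D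
      ...   | inj₂ _    = decompose-var E y≡ v≡ D
      decompose E y D | lam _   = decompose-lam E y≡ D
      decompose E y D | app _ _ = decompose-app E y≡ D
      decompose E y D | cA _    = decompose-cA E y≡ D
      decompose E y D | cB      = decompose-cB E y≡ D
      decompose E y D | cC      = decompose-cC E y≡ D
      decompose E y D | cΩ      = decompose-cΩ E y≡ D

      decompose-lam : ∀ E {γ β} {y : St SM (E ++ σ ∷ Δ) (γ ⇒ β)} {z} {Γ u w τ} → step SM y ≡ lam z →
                      J s S′ ℓ Γ (inM E refl y) u w τ → Decomposition E y Γ u w τ
      decompose-lam E y≡ (j-lam e D) with refl ← stepM≡ E y≡ e = decomposition-lam E y≡ (decompose (_ ∷ E) _ D)
      decompose-lam E y≡ (j-a e _ _)                     with () ← stepM≡ E y≡ e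
      decompose-lam E y≡ (j-b₁ e _ _)                    with () ← stepM≡ E y≡ e
      decompose-lam E y≡ (j-b₂ e _ _)                    with () ← stepM≡ E y≡ e
      decompose-lam E y≡ (j-var e _ _ _)                 with () ← stepM≡ E y≡ e
      decompose-lam E y≡ (j-app e _ _ _ _ _ _ _ _ _ _ _) with () ← stepM≡ E y≡ e

      decompose-app : ∀ E {γ β} {y : St SM (E ++ σ ∷ Δ) β} {K : St SM _ (γ ⇒ β)} {L} {Γ u w τ} → step SM y ≡ app K L →
                      J s S′ ℓ Γ (inM E refl y) u w τ → Decomposition E y Γ u w τ
      decompose-app E y≡ (j-app e Γ₀ u₀ w₀ DK Γs us ws DL hA hu hw) with refl ← stepM≡ E y≡ e =
        decomposition-app E y≡ Γ₀ u₀ w₀ (decompose E _ DK) Γs us ws (λ i → decompose E _ (DL i)) hA hu hw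
      decompose-app E y≡ (j-a e _ _)     with () ← stepM≡ E y≡ e
      decompose-app E y≡ (j-c e _ _)     with () ← stepM≡ E y≡ e
      decompose-app E y≡ (j-b₁ e _ _)    with () ← stepM≡ E y≡ e
      decompose-app E y≡ (j-b₂ e _ _)    with () ← stepM≡ E y≡ e
      decompose-app E y≡ (j-var e _ _ _) with () ← stepM≡ E y≡ e
      decompose-app E y≡ (j-lam e _)     with () ← stepM≡ E y≡ e

    module Conclusion {Γ : Env s Δ} {u w τ} (R : Decomposition [] (Term.root M) Γ u w τ) where
      open Decomposition R
      open Pruning (prune copies)

      private
        reordered : Σ (List NTyping) λ K → (keys K ≡ X) × (K ↭ kept)
        reordered = reorderByKeys X kept (λ p → trans (countEq-X p) (sym (countEq-kept p)))

      selected : List NTyping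
      selected = proj₁ reordered

      selectedPair : Fin (length selected) → Pair σ
      selectedPair i = key (lookup selected i)

      tabulate-selectedPair : tabulate selectedPair ≡ X
      tabulate-selectedPair = trans (sym (map-tabulate (lookup selected) key))
                            (trans (cong keys (tabulate-lookup selected)) (proj₁ (proj₂ reordered)))

      family-selectedPair : family s selectedPair ≡ X
      family-selectedPair = trans (cong (norm s) tabulate-selectedPair) X-normal

      atMostS-selectedPair : AtMostS s selectedPair
      atMostS-selectedPair p g g-injective all-p = 1+n≰n (begin
        suc s                          ≤⟨ countEq-tabulate-≥ selectedPair p g g-injective all-p ⟩
        countEq s p (tabulate selectedPair)    ≡⟨ cong (countEq s p) tabulate-selectedPair ⟩
        countEq s p X                  ≡⟨ countEq-X p ⟩
        countEq s p (keys copies) ⊓ s  ≤⟨ m⊓n≤n _ s ⟩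
        s                              ∎)
        where open ≤-Reasoning

      ∑-selected : ∀ a → ∑ s (λ i → weight (lookup selected i) a) ≡ total kept a
      ∑-selected a = trans (∑-lookup selected a) (total-↭ (proj₂ (proj₂ reordered)) a)

      dropped≡extra : ∀ a → dropped a ≡ extra a
      dropped≡extra a = +-cancelʳ-≡ (length (restrictAₘ a X)) (dropped a) (extra a) (begin-equality
        dropped a + length (restrictAₘ a X)              ≡⟨ cong (λ l → dropped a + length (restrictAₘ a l)) (proj₁ (proj₂ reordered)) ⟨
        dropped a + length (restrictAₘ a (keys selected)) ≡⟨ cong (dropped a +_) (length-restrictAₘ-↭ (proj₂ (proj₂ reordered)) a) ⟩
        dropped a + length (restrictAₘ a (keys kept))     ≡⟨ dropped-restrictA a ⟩
        length (restrictAₘ a (keys copies))               ≡⟨ extra-restrictA a ⟨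
        extra a + length (restrictAₘ a X)                 ∎)
        where open ≤-Reasoning

      weight-bound : ∀ a → 2 ^ u a * w a ≤ 2 ^ u′ a * (w′ a + ∑ s (λ i → weight (lookup selected i) a))
      weight-bound a = begin
        2 ^ u a * w a                                            ≡⟨ cong (2 ^ u a *_) (w≡ a) ⟩
        2 ^ u a * (w′ a + total copies a)                        ≤⟨ *-monoʳ-≤ (2 ^ u a) (+-mono-≤ (n≤2^m*n (dropped a) (w′ a)) (total≤ a)) ⟩
        2 ^ u a * (2 ^ dropped a * w′ a + 2 ^ dropped a * total kept a) ≡⟨ cong (2 ^ u a *_) (*-distribˡ-+ (2 ^ dropped a) (w′ a) _) ⟨
        2 ^ u a * (2 ^ dropped a * (w′ a + total kept a))        ≡⟨ *-assoc (2 ^ u a) (2 ^ dropped a) _ ⟨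
        2 ^ u a * 2 ^ dropped a * (w′ a + total kept a)          ≡⟨ cong₂ _*_ 2^u+dropped (cong (w′ a +_) (∑-selected a)) ⟨
        2 ^ u′ a * (w′ a + ∑ s (λ i → weight (lookup selected i) a)) ∎
        where
          open ≤-Reasoning
          2^u+dropped : 2 ^ u′ a ≡ 2 ^ u a * 2 ^ dropped a
          2^u+dropped = trans (cong (2 ^_) (trans (u′≡ a) (cong (u a +_) (sym (dropped≡extra a)))))
                              (^-distribˡ-+-* 2 (u a) (dropped a))

      u≤u′ : ∀ a → u a ≤ u′ a
      u≤u′ a = subst (u a ≤_) (sym (u′≡ a)) (m≤m+n (u a) (extra a))

      zero-preserved : ∀ a → u a + w a ≡ 0 → u′ a + (w′ a + ∑ s (λ i → weight (lookup selected i) a)) ≡ 0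
      zero-preserved a uw≡0 = cong₂ _+_ u′≡0 (cong₂ _+_ w′≡0 (trans (∑-selected a) kept≡0))
        where
          w′+total≡0 : w′ a + total copies a ≡ 0
          w′+total≡0 = trans (sym (w≡ a)) (m+n≡0⇒n≡0 (u a) uw≡0)

          w′≡0 : w′ a ≡ 0
          w′≡0 = m+n≡0⇒m≡0 (w′ a) w′+total≡0

          total≡0 : total copies a ≡ 0
          total≡0 = m+n≡0⇒n≡0 (w′ a) w′+total≡0

          extra≡0 : extra a ≡ 0
          extra≡0 = m+n≡0⇒m≡0 (extra a) (trans (extra-restrictA a) (total≡0⇒restrictA≡[] copies a total≡0))

          u′≡0 : u′ a ≡ 0
          u′≡0 = trans (u′≡ a) (cong₂ _+_ (m+n≡0⇒m≡0 (u a) uw≡0) extra≡0)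

          kept≡0 : total kept a ≡ 0
          kept≡0 = n≤0⇒n≡0 (subst (total kept a ≤_) total≡0 (total-kept≤ a))

lemma13 : (s : ℕ) → 1 ≤ s → (ℓ : ℕ) →
    ∀ {Δ σ α} (Γ : Env s Δ) (M : Term s (σ ∷ Δ) α) (N : Term s [] σ)
    (u w : Fin s → ℕ) (τ : Ty s α) →
    ord σ ≡ ℓ →
    ¬ VarOfOrder≥Occurs s ℓ N →
    Derivable s ℓ Γ (_[_/x] s M N) u w τ →
    Σ ℕ λ k →
    Σ (Fin s → ℕ) λ u₀' →
    Σ (Fin s → ℕ) λ w₀' →
    Σ (Fin k → Fin s → ℕ) λ w' →
    Σ (Fin k → Ty s σ) λ τ' →
      AtMostS s (λ i → (support s (w' i) , τ' i))
      × Derivable s ℓ (family s (λ i → (support s (w' i) , τ' i)) ∷ Γ) M u₀' w₀' τ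
      × (∀ i → Derivable s ℓ (∅ₑ s) N (λ _ → 0) (w' i) (τ' i))
      × (∀ a → (2 ^ u a * w a ≤ 2 ^ u₀' a * (w₀' a + ∑ s (λ i → w' i a)))
             × (u a ≤ u₀' a)
             × (u a + w a ≡ 0 → u₀' a + (w₀' a + ∑ s (λ i → w' i a)) ≡ 0))
lemma13 s s≥1 ℓ Γ M N u w τ σ≡ℓ ¬occ D =
  length selected , u′ , w′ , (λ i → NTyping.weight (lookup selected i)) , (λ i → NTyping.type (lookup selected i)) ,
  atMostS-selectedPair ,
  subst (λ X → J s (Term.sys M) ℓ (X ∷ Γ) (Term.root M) u′ w′ τ) (sym family-selectedPair) derivation ,
  (λ i → NTyping.derivation (lookup selected i)) ,
  (λ a → weight-bound a , u≤u′ a , zero-preserved a)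
  where
    open SubstitutionLemma s s≥1 ℓ M N σ≡ℓ ¬occ
    R : Decomposition [] (Term.root M) Γ u w τ
    R = decompose [] (Term.root M) D
    open Decomposition R
    open Conclusion R
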